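{- Let $Z$ be a $d$-dimensional lattice zonotope in $\mathbb{R}^d$ and let $p$ be a positive integer. If $\delta(H_1(d,p))\leq\delta(Z)$, then $k(H_1(d,p))\leq k(Z)$. If moreover $\delta(H_1(d,p))<\delta(Z)$, then $k(H_1(d,p))<k(Z)$. If $\delta(H_1(d,p))=\delta(Z)$ and $k(H_1(d,p))=k(Z)$, then $Z$ is a translate of $H_1(d,p)$.
   Context: A lattice polytope in $\mathbb{R}^d$ is a polytope with all vertices in $\mathbb{Z}^d$. A zonotope is a Minkowski sum of finitely many pairwise non-collinear line segments; a lattice zonotope is a zonotope that is a lattice polytope. A point of $\mathbb{Z}^d$ is primitive if it is nonzero and the gcd of its coordinates is $1$. For a positive integer $p$, $H_1(d,p)$ is the zonotope $\sum_x[0,x]$, where $x$ ranges over all primitive points of $\mathbb{Z}^d$ with $\|x\|_1\leq p$ whose first nonzero coordinate is positive. For a polytope $P$, $\delta(P)$ is the diameter of its graph (vertices and edges). For a $d$-dimensional lattice polytope $P$, $k(P)$ is the smallest integer $k$ such that some translate of $P$ by a vector of $\mathbb{Z}^d$ is contained in $[0,k]^d$. -}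

module Defs where

open import Data.Nat as ℕ using (ℕ; zero; suc)
open import Data.Nat.GCD using (gcd)
open import Data.Integer as ℤ using (ℤ; +_; 0ℤ; ∣_∣)
open import Data.Vec using (Vec; []; _∷_; zipWith; replicate; map)
open import Data.Vec.Relation.Unary.All as VAll using ()
open import Data.List as L using (List; []; _∷_; _++_)
open import Data.List.Membership.Propositional using (_∈_)
open import Data.List.Relation.Unary.All using (All)
open import Data.List.Relation.Unary.AllPairs using (AllPairs)
open import Data.Product using (Σ; ∃; ∃₂; _×_; _,_)
open import Data.Sum using (_⊎_)
open import Data.Empty using (⊥)
open import Relation.Nullary using (¬_)
open import Relation.Binary.PropositionalEquality using (_≡_; _≢_)

Pt : ℕ → Set
Pt d = Vec ℤ d

module _ {d : ℕ} where

  zeroV : Pt d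
  zeroV = replicate d 0ℤ

  _⊕_ : Pt d → Pt d → Pt d
  _⊕_ = zipWith ℤ._+_

  _⊖_ : Pt d → Pt d → Pt d
  _⊖_ = zipWith ℤ._-_

  scale : ℤ → Pt d → Pt d
  scale a = map (a ℤ.*_)

dot : ∀ {d} → Pt d → Pt d → ℤ
dot [] [] = 0ℤ
dot (x ∷ xs) (y ∷ ys) = x ℤ.* y ℤ.+ dot xs ys

l1 : ∀ {d} → Pt d → ℕ
l1 [] = 0
l1 (x ∷ xs) = ∣ x ∣ ℕ.+ l1 xs

vgcd : ∀ {d} → Pt d → ℕ
vgcd [] = 0
vgcd (x ∷ xs) = gcd ∣ x ∣ (vgcd xs)

Primitive : ∀ {d} → Pt d → Set
Primitive x = (x ≢ zeroV) × (vgcd x ≡ 1)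

FirstNonzeroPos : ∀ {d} → Pt d → Set
FirstNonzeroPos [] = ⊥
FirstNonzeroPos (x ∷ xs) = (0ℤ ℤ.< x) ⊎ ((x ≡ 0ℤ) × FirstNonzeroPos xs)

IsH1Gen : ∀ {d} → ℕ → Pt d → Set
IsH1Gen p x = Primitive x × (l1 x ℕ.≤ p) × FirstNonzeroPos x

-- all subset sums of a list of generators (vertices of Σ[0,g] are among these)
subsetSums : ∀ {d} → List (Pt d) → List (Pt d)
subsetSums [] = zeroV ∷ []
subsetSums (g ∷ gs) = subsetSums gs ++ L.map (g ⊕_) (subsetSums gs)

-- finite point set whose convex hull is the zonotope t + Σ_i [0, g_i]
zonoPoints : ∀ {d} → Pt d → List (Pt d) → List (Pt d)
zonoPoints t gs = L.map (t ⊕_) (subsetSums gs)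

Collinear : ∀ {d} → Pt d → Pt d → Set
Collinear g h = ∃₂ λ (a b : ℤ) → ((a ≢ 0ℤ) ⊎ (b ≢ 0ℤ)) × (scale a g ≡ scale b h)

ZonoGens : ∀ {d} → List (Pt d) → Set
ZonoGens gs = All (λ g → g ≢ zeroV) gs × AllPairs (λ g h → ¬ Collinear g h) gs

-- conv(S) is d-dimensional: not contained in any (rational) hyperplane
FullDim : ∀ {d} → List (Pt d) → Set
FullDim {d} S = (c : Pt d) → c ≢ zeroV →
  ∃₂ λ u w → (u ∈ S) × (w ∈ S) × (dot c u ≢ dot c w)

-- Face structure of conv(S) for a finite S ⊆ ℤ^d
-- (faces of rational polytopes are exposed by integer functionals)

Maximizer : ∀ {d} → Pt d → List (Pt d) → Pt d → Set
Maximizer c S w = (w ∈ S) × (∀ u → u ∈ S → dot c u ℤ.≤ dot c w)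

IsVertex : ∀ {d} → List (Pt d) → Pt d → Set
IsVertex {d} S v = Σ (Pt d) λ c → Maximizer c S v × (∀ w → Maximizer c S w → w ≡ v)

OnSegment : ∀ {d} → Pt d → Pt d → Pt d → Set
OnSegment u v w = ∃₂ λ (a b : ℕ) → (0 ℕ.< b) × (a ℕ.≤ b) ×
  (scale (+ b) (w ⊖ u) ≡ scale (+ a) (v ⊖ u))

IsEdge : ∀ {d} → List (Pt d) → Pt d → Pt d → Set
IsEdge {d} S u v = IsVertex S u × IsVertex S v × (u ≢ v) ×
  Σ (Pt d) λ c → Maximizer c S u × Maximizer c S v ×
    (∀ w → Maximizer c S w → OnSegment u v w)

data Walk {d : ℕ} (S : List (Pt d)) : Pt d → Pt d → ℕ → Set where
  here : ∀ {v} → IsVertex S v → Walk S v v 0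
  step : ∀ {u w v n} → IsEdge S u w → Walk S w v n → Walk S u v (suc n)

Diameter : ∀ {d} → List (Pt d) → ℕ → Set
Diameter S n =
  (∀ u v → IsVertex S u → IsVertex S v → ∃ λ m → (m ℕ.≤ n) × Walk S u v m) ×
  (∃₂ λ u v → IsVertex S u × IsVertex S v × (∀ m → Walk S u v m → n ℕ.≤ m))

InBox : ∀ {d} → ℕ → Pt d → Set
InBox k x = VAll.All (λ xi → (0ℤ ℤ.≤ xi) × (xi ℤ.≤ + k)) x

FitsIn : ∀ {d} → List (Pt d) → ℕ → Set
FitsIn {d} S k = Σ (Pt d) λ t → ∀ w → w ∈ S → InBox k (w ⊕ t)

KVal : ∀ {d} → List (Pt d) → ℕ → Set
KVal S k = FitsIn S k × (∀ j → FitsIn S j → k ℕ.≤ j)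

IsTranslateOf : ∀ {d} → List (Pt d) → List (Pt d) → Set
IsTranslateOf {d} S T = Σ (Pt d) λ t →
  (∀ v → IsVertex T v → IsVertex S (v ⊕ t)) ×
  (∀ v → IsVertex S v → ∃ λ u → IsVertex T u × (v ≡ u ⊕ t))

-- Let H = H₁(d,p) have N generators, Z have n, and put s = p + 1.
-- The vertices of a zonotope t + ∑ᵢ [0,gᵢ] with pairwise non-collinear generators are the points
-- t + ∑_{i∈σ} gᵢ selected by some functional, an edge changes σ in exactly one generator, and moving
-- a functional selecting σ towards one selecting τ crosses the walls ⟨·,gᵢ⟩ = 0 one at a time; so
-- vertices at Hamming distance m are at graph distance m, and δ(Z) ≤ n. The functional
-- (s^(d-1), …, s, 1) is positive on every generator of H, so its two antipodal vertices give N ≤ δ(H).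
-- In any box [0,k]^d the i-th coordinate of Z spans the column sum ∑_g |g_i|, so ∑_g ‖g‖₁ ≤ d k(Z);
-- the cyclic symmetry of H equalises its column sums, so d k(H) ≤ ∑_h ‖h‖₁. Matching each g with
-- its primitive direction gives ∑_h ‖h‖₁ + n s ≤ ∑_g ‖g‖₁ + N s, with equality only if g ↦ ±prim g
-- is a bijection onto the generators of H.

module Submission where

module Integers where

  open import Data.Nat as ℕ using (ℕ)
  import Data.Nat.Properties as ℕₚ
  open import Data.Integer using (ℤ; +_; +[1+_]; -[1+_]; 0ℤ; -_; _+_; _*_; _<_; _≤_; ∣_∣; +<+; -≤+)
  import Data.Integer.Properties as ℤₚ
  open import Data.Integer.Tactic.RingSolver using (solve-∀)
  open import Data.Sum using (_⊎_; inj₁; inj₂)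
  open import Data.Empty using (⊥-elim)
  open import Relation.Binary.Definitions using (tri<; tri≈; tri>)
  open import Relation.Binary.PropositionalEquality

  ≢0⇒>0∨<0 : ∀ a → a ≢ 0ℤ → 0ℤ < a ⊎ a < 0ℤ
  ≢0⇒>0∨<0 a a≢0 with ℤₚ.<-cmp a 0ℤ
  ... | tri< a<0 _ _ = inj₂ a<0
  ... | tri≈ _ a≡0 _ = ⊥-elim (a≢0 a≡0)
  ... | tri> _ _ a>0 = inj₁ a>0

  0<-a⇒a<0 : ∀ {a} → 0ℤ < - a → a < 0ℤ
  0<-a⇒a<0 {a} h = subst (_< 0ℤ) (ℤₚ.neg-involutive a) (ℤₚ.neg-mono-< h)

  -∣a∣≤a : ∀ a → - (+ ∣ a ∣) ≤ a
  -∣a∣≤a (+ 0) = ℤₚ.≤-refl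
  -∣a∣≤a +[1+ n ] = -≤+
  -∣a∣≤a -[1+ n ] = ℤₚ.≤-refl

  +-cancelˡ-≤ : ∀ x {b c} → x + b ≤ x + c → b ≤ c
  +-cancelˡ-≤ x {b} {c} h = subst₂ _≤_ (-x+[x+y]≡y x b) (-x+[x+y]≡y x c) (ℤₚ.+-monoʳ-≤ (- x) h)
    where
    -x+[x+y]≡y : ∀ (x y : ℤ) → - x + (x + y) ≡ y
    -x+[x+y]≡y = solve-∀

  +-cancelʳ-≤ : ∀ x {b c} → b + x ≤ c + x → b ≤ c
  +-cancelʳ-≤ x {b} {c} h = +-cancelˡ-≤ x (subst₂ _≤_ (ℤₚ.+-comm b x) (ℤₚ.+-comm c x) h)

  K*x+e>0 : ∀ (K : ℕ) x e → 0ℤ < x → ∣ e ∣ ℕ.< K → 0ℤ < + K * x + e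
  K*x+e>0 K x e x>0 ∣e∣<K = subst (_< + K * x + e) (ℤₚ.+-inverseʳ (+ K)) (ℤₚ.+-mono-≤-< K≤Kx -K<e)
    where
    K≤Kx : + K ≤ + K * x
    K≤Kx = subst (_≤ + K * x) (ℤₚ.*-identityʳ (+ K)) (ℤₚ.*-monoˡ-≤-nonNeg (+ K) (ℤₚ.i<j⇒suc[i]≤j x>0))
    -K<e : - (+ K) < e
    -K<e = ℤₚ.<-≤-trans (ℤₚ.neg-mono-< (+<+ ∣e∣<K)) (-∣a∣≤a e)

  ratio-≤-trans : ∀ eᵢ eⱼ eₖ aᵢ aⱼ aₖ → 0 ℕ.< aⱼ →
    eᵢ ℕ.* aⱼ ℕ.≤ eⱼ ℕ.* aᵢ → eⱼ ℕ.* aₖ ℕ.≤ eₖ ℕ.* aⱼ → eᵢ ℕ.* aₖ ℕ.≤ eₖ ℕ.* aᵢ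
  ratio-≤-trans eᵢ eⱼ eₖ aᵢ aⱼ aₖ aⱼ>0 i≼j j≼k = ℕₚ.*-cancelʳ-≤ (eᵢ ℕ.* aₖ) (eₖ ℕ.* aᵢ) aⱼ {{ℕ.>-nonZero aⱼ>0}} (begin
    eᵢ ℕ.* aₖ ℕ.* aⱼ  ≡⟨ swap eᵢ aₖ aⱼ ⟩
    eᵢ ℕ.* aⱼ ℕ.* aₖ  ≤⟨ ℕₚ.*-monoˡ-≤ aₖ i≼j ⟩
    eⱼ ℕ.* aᵢ ℕ.* aₖ  ≡⟨ swap eⱼ aᵢ aₖ ⟩
    eⱼ ℕ.* aₖ ℕ.* aᵢ  ≤⟨ ℕₚ.*-monoˡ-≤ aᵢ j≼k ⟩
    eₖ ℕ.* aⱼ ℕ.* aᵢ  ≡⟨ swap eₖ aⱼ aᵢ ⟩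
    eₖ ℕ.* aᵢ ℕ.* aⱼ  ∎)
    where
    open ℕₚ.≤-Reasoning
    swap : ∀ a b e → a ℕ.* b ℕ.* e ≡ a ℕ.* e ℕ.* b
    swap a b e = trans (ℕₚ.*-assoc a b e) (trans (cong (a ℕ.*_) (ℕₚ.*-comm b e)) (sym (ℕₚ.*-assoc a e b)))

module Vectors where

  open import Defs
  open import Data.Nat using (ℕ; zero; suc; z≤n; s≤s)
  open import Data.Integer as ℤ using (ℤ; ≢-nonZero; +≤+; +<+; +_; +[1+_]; -[1+_]; 0ℤ; -_; _+_; _-_; _*_; _<_; _≤_)
  import Data.Integer.Properties as ℤₚ
  open import Data.Integer.Tactic.RingSolver using (solve-∀)
  open import Data.Vec as Vec using ([]; _∷_; lookup; replicate)
  import Data.Vec.Properties as Vecₚ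
  open import Data.Fin using (Fin; zero; suc)
  open import Data.Product using (Σ; _×_; _,_)
  open import Data.Sum using (inj₁; inj₂; [_,_]′; swap)
  open import Data.Empty using (⊥-elim)
  open import Relation.Nullary using (¬_; Dec; yes; no)
  open import Relation.Binary.PropositionalEquality

  neg : ∀ {d} → Pt d → Pt d
  neg = Vec.map (λ a → - a)

  module _ {d : ℕ} where

    ⊕-comm : (x y : Pt d) → x ⊕ y ≡ y ⊕ x
    ⊕-comm = Vecₚ.zipWith-comm ℤₚ.+-comm

    ⊕-assoc : (x y z : Pt d) → (x ⊕ y) ⊕ z ≡ x ⊕ (y ⊕ z)
    ⊕-assoc = Vecₚ.zipWith-assoc ℤₚ.+-assoc

    ⊕-identityˡ : (x : Pt d) → zeroV ⊕ x ≡ x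
    ⊕-identityˡ = Vecₚ.zipWith-identityˡ ℤₚ.+-identityˡ

    ⊕-identityʳ : (x : Pt d) → x ⊕ zeroV ≡ x
    ⊕-identityʳ = Vecₚ.zipWith-identityʳ ℤₚ.+-identityʳ

    ⊕-inverseˡ : (x : Pt d) → neg x ⊕ x ≡ zeroV
    ⊕-inverseˡ = Vecₚ.zipWith-inverseˡ ℤₚ.+-inverseˡ

    [x⊕u]⊕neg[u]≡x : (x u : Pt d) → (x ⊕ u) ⊕ neg u ≡ x
    [x⊕u]⊕neg[u]≡x x u = begin
      (x ⊕ u) ⊕ neg u  ≡⟨ ⊕-assoc x u (neg u) ⟩
      x ⊕ (u ⊕ neg u)  ≡⟨ cong (x ⊕_) (trans (⊕-comm u (neg u)) (⊕-inverseˡ u)) ⟩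
      x ⊕ zeroV        ≡⟨ ⊕-identityʳ x ⟩
      x                ∎
      where open ≡-Reasoning

    [u⊕x]⊕neg[u]≡x : (u x : Pt d) → (u ⊕ x) ⊕ neg u ≡ x
    [u⊕x]⊕neg[u]≡x u x = trans (cong (_⊕ neg u) (⊕-comm u x)) ([x⊕u]⊕neg[u]≡x x u)

    ⊕-cancelʳ : (x y u : Pt d) → x ⊕ u ≡ y ⊕ u → x ≡ y
    ⊕-cancelʳ x y u e = begin
      x                  ≡⟨ [x⊕u]⊕neg[u]≡x x u ⟨
      (x ⊕ u) ⊕ neg u    ≡⟨ cong (_⊕ neg u) e ⟩
      (y ⊕ u) ⊕ neg u    ≡⟨ [x⊕u]⊕neg[u]≡x y u ⟩
      y                  ∎
      where open ≡-Reasoning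

    neg-involutive : (x : Pt d) → neg (neg x) ≡ x
    neg-involutive x = trans (sym (Vecₚ.map-∘ (λ a → - a) (λ a → - a) x)) (trans (Vecₚ.map-cong ℤₚ.neg-involutive x) (Vecₚ.map-id x))

    scale-∘ : ∀ a b (x : Pt d) → scale a (scale b x) ≡ scale (a * b) x
    scale-∘ a b x = trans (sym (Vecₚ.map-∘ (a *_) (b *_) x)) (Vecₚ.map-cong (λ c → sym (ℤₚ.*-assoc a b c)) x)

    scale-comm : ∀ a b (x : Pt d) → scale a (scale b x) ≡ scale b (scale a x)
    scale-comm a b x = trans (scale-∘ a b x) (trans (cong (λ k → scale k x) (ℤₚ.*-comm a b)) (sym (scale-∘ b a x)))

    scale-identityˡ : (x : Pt d) → scale (+ 1) x ≡ x
    scale-identityˡ x = trans (Vecₚ.map-cong ℤₚ.*-identityˡ x) (Vecₚ.map-id x)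

    scale-[-1]≡neg : (x : Pt d) → scale -[1+ 0 ] x ≡ neg x
    scale-[-1]≡neg = Vecₚ.map-cong ℤₚ.-1*i≡-i

    scale-neg : ∀ k (x : Pt d) → scale (- k) x ≡ scale k (neg x)
    scale-neg k x = trans (Vecₚ.map-cong (λ c → trans (sym (ℤₚ.neg-distribˡ-* k c)) (ℤₚ.neg-distribʳ-* k c)) x) (Vecₚ.map-∘ (k *_) (λ a → - a) x)

    scale-zeroˡ : (x : Pt d) → scale 0ℤ x ≡ zeroV
    scale-zeroˡ x = trans (Vecₚ.map-cong ℤₚ.*-zeroˡ x) (Vecₚ.map-const x 0ℤ)

    scale-zeroʳ : ∀ k → scale k (zeroV {d}) ≡ zeroV
    scale-zeroʳ k = trans (Vecₚ.map-replicate (k *_) 0ℤ d) (cong (replicate d) (ℤₚ.*-zeroʳ k))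

  scale-cancelˡ : ∀ {d} k (x y : Pt d) → k ≢ 0ℤ → scale k x ≡ scale k y → x ≡ y
  scale-cancelˡ k [] [] k≢0 e = refl
  scale-cancelˡ k (a ∷ x) (b ∷ y) k≢0 e =
    cong₂ _∷_ (ℤₚ.*-cancelˡ-≡ k a b {{≢-nonZero k≢0}} (cong Vec.head e)) (scale-cancelˡ k x y k≢0 (cong Vec.tail e))

  scale≡zeroV⇒≡zeroV : ∀ {d} k (x : Pt d) → k ≢ 0ℤ → scale k x ≡ zeroV → x ≡ zeroV
  scale≡zeroV⇒≡zeroV k x k≢0 e = scale-cancelˡ k x zeroV k≢0 (trans e (sym (scale-zeroʳ k)))

  dot-distribʳ-⊕ : ∀ {d} (c x y : Pt d) → dot c (x ⊕ y) ≡ dot c x + dot c y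
  dot-distribʳ-⊕ [] [] [] = refl
  dot-distribʳ-⊕ (c ∷ cs) (a ∷ x) (b ∷ y) rewrite dot-distribʳ-⊕ cs x y = shuffle c a b (dot cs x) (dot cs y)
    where
    shuffle : ∀ (c a b u v : ℤ) → c * (a + b) + (u + v) ≡ c * a + u + (c * b + v)
    shuffle = solve-∀

  dot-distribˡ-⊕ : ∀ {d} (c c′ x : Pt d) → dot (c ⊕ c′) x ≡ dot c x + dot c′ x
  dot-distribˡ-⊕ [] [] [] = refl
  dot-distribˡ-⊕ (c ∷ cs) (c′ ∷ cs′) (a ∷ x) rewrite dot-distribˡ-⊕ cs cs′ x = shuffle c c′ a (dot cs x) (dot cs′ x)
    where
    shuffle : ∀ (c c′ a u v : ℤ) → (c + c′) * a + (u + v) ≡ c * a + u + (c′ * a + v)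
    shuffle = solve-∀

  dot-scaleˡ : ∀ {d} k (c x : Pt d) → dot (scale k c) x ≡ k * dot c x
  dot-scaleˡ k [] [] = sym (ℤₚ.*-zeroʳ k)
  dot-scaleˡ k (c ∷ cs) (a ∷ x) rewrite dot-scaleˡ k cs x = shuffle k c a (dot cs x)
    where
    shuffle : ∀ (k c a u : ℤ) → k * c * a + k * u ≡ k * (c * a + u)
    shuffle = solve-∀

  dot-negˡ : ∀ {d} (c x : Pt d) → dot (neg c) x ≡ - dot c x
  dot-negˡ c x = begin
    dot (neg c) x                ≡⟨ cong (λ c′ → dot c′ x) (scale-[-1]≡neg c) ⟨
    dot (scale -[1+ 0 ] c) x     ≡⟨ dot-scaleˡ -[1+ 0 ] c x ⟩
    -[1+ 0 ] * dot c x           ≡⟨ ℤₚ.-1*i≡-i (dot c x) ⟩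
    - dot c x                    ∎
    where open ≡-Reasoning

  dot-zeroˡ : ∀ {d} (x : Pt d) → dot zeroV x ≡ 0ℤ
  dot-zeroˡ [] = refl
  dot-zeroˡ (a ∷ x) rewrite dot-zeroˡ x | ℤₚ.*-zeroˡ a = refl

  dot-zeroʳ : ∀ {d} (c : Pt d) → dot c zeroV ≡ 0ℤ
  dot-zeroʳ [] = refl
  dot-zeroʳ (c ∷ cs) rewrite dot-zeroʳ cs | ℤₚ.*-zeroʳ c = refl

  0≤a*a : ∀ a → 0ℤ ≤ a * a
  0≤a*a (+ n) rewrite sym (ℤₚ.pos-* n n) = +≤+ z≤n
  0≤a*a -[1+ n ] = +≤+ z≤n

  0<a*a : ∀ a → a ≢ 0ℤ → 0ℤ < a * a
  0<a*a (+ 0) a≢0 = ⊥-elim (a≢0 refl)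
  0<a*a +[1+ n ] _ = +<+ (s≤s z≤n)
  0<a*a -[1+ n ] _ = +<+ (s≤s z≤n)

  0≤dot-self : ∀ {d} (x : Pt d) → 0ℤ ≤ dot x x
  0≤dot-self [] = ℤₚ.≤-refl
  0≤dot-self (a ∷ x) = ℤₚ.+-mono-≤ (0≤a*a a) (0≤dot-self x)

  0<dot-self : ∀ {d} (x : Pt d) → x ≢ zeroV → 0ℤ < dot x x
  0<dot-self [] x≢0 = ⊥-elim (x≢0 refl)
  0<dot-self (a ∷ x) ax≢0 with a ℤ.≟ 0ℤ
  ... | no a≢0 = ℤₚ.+-mono-<-≤ (0<a*a a a≢0) (0≤dot-self x)
  ... | yes refl = ℤₚ.+-mono-≤-< (ℤₚ.≤-refl {0ℤ}) (0<dot-self x (λ x≡0 → ax≢0 (cong (0ℤ ∷_) x≡0)))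

  distinguishing-coordinate : ∀ {d} (u v : Pt d) → u ≢ v → Σ (Fin d) λ i → lookup u i ≢ lookup v i
  distinguishing-coordinate [] [] u≢v = ⊥-elim (u≢v refl)
  distinguishing-coordinate (a ∷ u) (b ∷ v) au≢bv with a ℤ.≟ b
  ... | no a≢b = zero , a≢b
  ... | yes refl with distinguishing-coordinate u v (λ u≡v → au≢bv (cong (a ∷_) u≡v))
  ...   | i , uᵢ≢vᵢ = suc i , uᵢ≢vᵢ

  unit : ∀ {d} → Fin d → Pt d
  unit {suc d} zero = + 1 ∷ zeroV
  unit {suc d} (suc i) = 0ℤ ∷ unit i

  dot-unit : ∀ {d} (i : Fin d) (x : Pt d) → dot (unit i) x ≡ lookup x i
  dot-unit zero (a ∷ x) rewrite dot-zeroˡ x = trans (ℤₚ.+-identityʳ _) (ℤₚ.*-identityˡ a)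
  dot-unit (suc i) (a ∷ x) rewrite dot-unit i x = ℤₚ.+-identityˡ _

  minor : ∀ {d} → Fin d → Fin d → Pt d → Pt d
  minor p q x = scale (lookup x q) (unit p) ⊕ scale (- lookup x p) (unit q)

  dot-minor : ∀ {d} p q (x z : Pt d) → dot (minor p q x) z ≡ lookup x q * lookup z p + - lookup x p * lookup z q
  dot-minor p q x z = begin
    dot (minor p q x) z
      ≡⟨ dot-distribˡ-⊕ (scale (lookup x q) (unit p)) (scale (- lookup x p) (unit q)) z ⟩
    dot (scale (lookup x q) (unit p)) z + dot (scale (- lookup x p) (unit q)) z
      ≡⟨ cong₂ _+_ (dot-scaleˡ (lookup x q) (unit p) z) (dot-scaleˡ (- lookup x p) (unit q) z) ⟩
    lookup x q * dot (unit p) z + - lookup x p * dot (unit q) z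
      ≡⟨ cong₂ (λ u v → lookup x q * u + - lookup x p * v) (dot-unit p z) (dot-unit q z) ⟩
    lookup x q * lookup z p + - lookup x p * lookup z q ∎
    where open ≡-Reasoning

  -- The witness x_q e_p − x_p e_q, where x_p ≠ 0 and x_p y_q ≠ y_p x_q.
  separating-functional : ∀ {d} (x y : Pt d) → x ≢ zeroV → ¬ Collinear x y →
    Σ (Pt d) λ w → (dot w x ≡ 0ℤ) × (dot w y ≢ 0ℤ)
  separating-functional x y x≢0 x∦y with distinguishing-coordinate x zeroV x≢0
  ... | p , xₚ≢0′ with distinguishing-coordinate (scale (lookup y p) x) (scale (lookup x p) y)
                         (λ e → x∦y (lookup y p , lookup x p , inj₂ xₚ≢0 , e))
    where xₚ≢0 = subst (lookup x p ≢_) (Vecₚ.lookup-replicate p 0ℤ) xₚ≢0′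
  ...   | q , differ = minor p q x , vanishes-on-x , nonzero-on-y
    where
    open ≡-Reasoning
    xq xp yp yq : ℤ
    xq = lookup x q
    xp = lookup x p
    yp = lookup y p
    yq = lookup y q
    vanishes-on-x : dot (minor p q x) x ≡ 0ℤ
    vanishes-on-x = trans (dot-minor p q x x) (antisymmetric xq xp)
      where
      antisymmetric : ∀ (u v : ℤ) → u * v + - v * u ≡ 0ℤ
      antisymmetric = solve-∀
    nonzero-on-y : dot (minor p q x) y ≢ 0ℤ
    nonzero-on-y e = differ (begin
      lookup (scale yp x) q     ≡⟨ Vecₚ.lookup-map q (yp *_) x ⟩
      yp * xq                   ≡⟨ rearrange yp xq xp yq ⟩
      (xq * yp + - xp * yq) + xp * yq ≡⟨ cong (_+ xp * yq) (trans (sym (dot-minor p q x y)) e) ⟩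
      0ℤ + xp * yq              ≡⟨ ℤₚ.+-identityˡ _ ⟩
      xp * yq                   ≡⟨ Vecₚ.lookup-map q (xp *_) y ⟨
      lookup (scale xp y) q     ∎)
      where
      rearrange : ∀ (a b c e : ℤ) → a * b ≡ (b * a + - c * e) + c * e
      rearrange = solve-∀

  parallel⇒collinear : ∀ {d} {x z y : Pt d} {α β a b : ℤ} → α ≢ 0ℤ → β ≢ 0ℤ → z ≢ zeroV →
    scale α x ≡ scale a y → scale β z ≡ scale b y → Collinear x z
  parallel⇒collinear {x = x} {z} {y} {α} {β} {a} {b} α≢0 β≢0 z≢0 ex ez = b * α , a * β , inj₁ bα≢0 , (begin
    scale (b * α) x      ≡⟨ scale-∘ b α x ⟨
    scale b (scale α x)  ≡⟨ cong (scale b) ex ⟩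
    scale b (scale a y)  ≡⟨ scale-comm b a y ⟩
    scale a (scale b y)  ≡⟨ cong (scale a) ez ⟨
    scale a (scale β z)  ≡⟨ scale-∘ a β z ⟩
    scale (a * β) z      ∎)
    where
    open ≡-Reasoning
    b≢0 : b ≢ 0ℤ
    b≢0 refl = z≢0 (scale≡zeroV⇒≡zeroV β z β≢0 (trans ez (scale-zeroˡ y)))
    bα≢0 : b * α ≢ 0ℤ
    bα≢0 e = [ b≢0 , α≢0 ]′ (ℤₚ.i*j≡0⇒i≡0∨j≡0 b e)

  _≟ᵥ_ : ∀ {d} (x y : Pt d) → Dec (x ≡ y)
  _≟ᵥ_ = Vecₚ.≡-dec ℤ._≟_

  ⊖-self : ∀ {d} (x : Pt d) → x ⊖ x ≡ zeroV
  ⊖-self [] = refl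
  ⊖-self (a ∷ x) = cong₂ _∷_ (ℤₚ.+-inverseʳ a) (⊖-self x)

  [t⊕[g⊕x]]⊖[t⊕x]≡g : ∀ {d} (t g x : Pt d) → (t ⊕ (g ⊕ x)) ⊖ (t ⊕ x) ≡ g
  [t⊕[g⊕x]]⊖[t⊕x]≡g [] [] [] = refl
  [t⊕[g⊕x]]⊖[t⊕x]≡g (a ∷ t) (b ∷ g) (c ∷ x) = cong₂ _∷_ (cancel a b c) ([t⊕[g⊕x]]⊖[t⊕x]≡g t g x)
    where
    cancel : ∀ (a b c : ℤ) → a + (b + c) - (a + c) ≡ b
    cancel = solve-∀

  [t⊕x]⊖[t⊕[g⊕x]]≡neg[g] : ∀ {d} (t g x : Pt d) → (t ⊕ x) ⊖ (t ⊕ (g ⊕ x)) ≡ neg g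
  [t⊕x]⊖[t⊕[g⊕x]]≡neg[g] [] [] [] = refl
  [t⊕x]⊖[t⊕[g⊕x]]≡neg[g] (a ∷ t) (b ∷ g) (c ∷ x) = cong₂ _∷_ (cancel a b c) ([t⊕x]⊖[t⊕[g⊕x]]≡neg[g] t g x)
    where
    cancel : ∀ (a b c : ℤ) → a + c - (a + (b + c)) ≡ - b
    cancel = solve-∀

  Collinear-sym : ∀ {d} {x y : Pt d} → Collinear x y → Collinear y x
  Collinear-sym (a , b , a≢0∨b≢0 , ax≡by) = b , a , swap a≢0∨b≢0 , sym ax≡by

module SubsetSums where

  open import Defs
  open Vectors
  open Integers using (+-cancelˡ-≤; +-cancelʳ-≤)
  open import Data.Nat as ℕ using (ℕ; zero; suc; z≤n; s≤s)
  import Data.Nat.Properties as ℕₚ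
  open import Data.Integer using (ℤ; 0ℤ; _+_; _≤_)
  import Data.Integer.Properties as ℤₚ
  open import Data.Bool as Bool using (Bool; true; false; not; _xor_)
  open import Data.Fin using (Fin; zero; suc)
  import Data.Fin.Properties as Finₚ
  open import Data.Vec.Functional as Vector using (updateAt)
  open import Data.List using (List; []; _∷_; lookup)
  open import Data.List.Membership.Propositional using (_∈_)
  open import Data.List.Membership.Propositional.Properties using (∈-map⁺; ∈-map⁻; ∈-++⁺ˡ; ∈-++⁺ʳ; ∈-++⁻)
  open import Data.List.Relation.Unary.Any using (here)
  open import Data.Product using (∃; _×_; _,_)
  open import Data.Sum using (_⊎_; inj₁; inj₂; [_,_]′)
  open import Data.Empty using (⊥; ⊥-elim)
  open import Function using (_∘_; id)
  open import Algebra.Properties.CommutativeSemigroup ℕₚ.+-commutativeSemigroup using (interchange)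
  open import Relation.Nullary using (Dec; yes; no)
  open import Relation.Binary.PropositionalEquality

  ∑ℕ : ∀ {n} → (Fin n → ℕ) → ℕ
  ∑ℕ {zero} f = 0
  ∑ℕ {suc n} f = f zero ℕ.+ ∑ℕ (f ∘ suc)

  ∑ℤ : ∀ {n} → (Fin n → ℤ) → ℤ
  ∑ℤ {zero} f = 0ℤ
  ∑ℤ {suc n} f = f zero + ∑ℤ (f ∘ suc)

  ∑ℕ-cong : ∀ {n} {f g : Fin n → ℕ} → (∀ i → f i ≡ g i) → ∑ℕ f ≡ ∑ℕ g
  ∑ℕ-cong {zero} f≗g = refl
  ∑ℕ-cong {suc n} f≗g = cong₂ ℕ._+_ (f≗g zero) (∑ℕ-cong (f≗g ∘ suc))

  ∑ℤ-cong : ∀ {n} {f g : Fin n → ℤ} → (∀ i → f i ≡ g i) → ∑ℤ f ≡ ∑ℤ g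
  ∑ℤ-cong {zero} f≗g = refl
  ∑ℤ-cong {suc n} f≗g = cong₂ _+_ (f≗g zero) (∑ℤ-cong (f≗g ∘ suc))

  ∑ℕ-mono-≤ : ∀ {n} {f g : Fin n → ℕ} → (∀ i → f i ℕ.≤ g i) → ∑ℕ f ℕ.≤ ∑ℕ g
  ∑ℕ-mono-≤ {zero} f≤g = z≤n
  ∑ℕ-mono-≤ {suc n} f≤g = ℕₚ.+-mono-≤ (f≤g zero) (∑ℕ-mono-≤ (f≤g ∘ suc))

  ∑ℕ-mono-< : ∀ {n} {f g : Fin n → ℕ} → (∀ i → f i ℕ.≤ g i) → ∀ k → f k ℕ.< g k → ∑ℕ f ℕ.< ∑ℕ g
  ∑ℕ-mono-< {suc n} f≤g zero fₖ<gₖ = ℕₚ.+-mono-<-≤ fₖ<gₖ (∑ℕ-mono-≤ (f≤g ∘ suc))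
  ∑ℕ-mono-< {suc n} f≤g (suc k) fₖ<gₖ = ℕₚ.+-mono-≤-< (f≤g zero) (∑ℕ-mono-< (f≤g ∘ suc) k fₖ<gₖ)

  ∑ℤ-mono-≤ : ∀ {n} {f g : Fin n → ℤ} → (∀ i → f i ≤ g i) → ∑ℤ f ≤ ∑ℤ g
  ∑ℤ-mono-≤ {zero} f≤g = ℤₚ.≤-refl
  ∑ℤ-mono-≤ {suc n} f≤g = ℤₚ.+-mono-≤ (f≤g zero) (∑ℤ-mono-≤ (f≤g ∘ suc))

  ∑ℕ-distrib-+ : ∀ {n} (f g : Fin n → ℕ) → ∑ℕ (λ i → f i ℕ.+ g i) ≡ ∑ℕ f ℕ.+ ∑ℕ g
  ∑ℕ-distrib-+ {zero} f g = refl
  ∑ℕ-distrib-+ {suc n} f g rewrite ∑ℕ-distrib-+ (f ∘ suc) (g ∘ suc) = interchange (f zero) (g zero) _ _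

  ∑ℕ-const : ∀ {n} (f : Fin n → ℕ) k → (∀ i → f i ≡ k) → ∑ℕ f ≡ n ℕ.* k
  ∑ℕ-const {zero} f k f≡k = refl
  ∑ℕ-const {suc n} f k f≡k = cong₂ ℕ._+_ (f≡k zero) (∑ℕ-const (f ∘ suc) k (f≡k ∘ suc))

  ∑ℕ-bound : ∀ {n} (f : Fin n → ℕ) k → (∀ i → f i ℕ.≤ k) → ∑ℕ f ℕ.≤ n ℕ.* k
  ∑ℕ-bound {zero} f k f≤k = z≤n
  ∑ℕ-bound {suc n} f k f≤k = ℕₚ.+-mono-≤ (f≤k zero) (∑ℕ-bound (f ∘ suc) k (f≤k ∘ suc))

  term≤∑ℕ : ∀ {n} (f : Fin n → ℕ) i → f i ℕ.≤ ∑ℕ f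
  term≤∑ℕ {suc n} f zero = ℕₚ.m≤m+n _ _
  term≤∑ℕ {suc n} f (suc i) = ℕₚ.≤-trans (term≤∑ℕ (f ∘ suc) i) (ℕₚ.m≤n+m _ _)

  ∑ℤ-tight : ∀ {n} {f g : Fin n → ℤ} → (∀ i → f i ≤ g i) → ∑ℤ g ≤ ∑ℤ f → ∀ i → f i ≡ g i
  ∑ℤ-tight {suc n} {f} {g} f≤g ∑g≤∑f zero = ℤₚ.≤-antisym (f≤g zero)
    (+-cancelʳ-≤ (∑ℤ (g ∘ suc)) (ℤₚ.≤-trans ∑g≤∑f (ℤₚ.+-monoʳ-≤ (f zero) (∑ℤ-mono-≤ (f≤g ∘ suc)))))
  ∑ℤ-tight {suc n} {f} {g} f≤g ∑g≤∑f (suc i) = ∑ℤ-tight (f≤g ∘ suc)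
    (+-cancelˡ-≤ (g zero) (ℤₚ.≤-trans ∑g≤∑f (ℤₚ.+-monoˡ-≤ (∑ℤ (f ∘ suc)) (f≤g zero)))) i

  select : ∀ {d} → Bool → Pt d → Pt d
  select true x = x
  select false x = zeroV

  selectℤ : Bool → ℤ → ℤ
  selectℤ true a = a
  selectℤ false a = 0ℤ

  subsetSum : ∀ {d n} → (Fin n → Pt d) → (Fin n → Bool) → Pt d
  subsetSum {n = zero} G σ = zeroV
  subsetSum {n = suc n} G σ = select (σ zero) (G zero) ⊕ subsetSum (G ∘ suc) (σ ∘ suc)

  subsetSum-cong : ∀ {d n} (G : Fin n → Pt d) {σ ρ} → (∀ i → σ i ≡ ρ i) → subsetSum G σ ≡ subsetSum G ρ
  subsetSum-cong {n = zero} G σ≗ρ = refl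
  subsetSum-cong {n = suc n} G σ≗ρ =
    cong₂ (λ b x → select b (G zero) ⊕ x) (σ≗ρ zero) (subsetSum-cong (G ∘ suc) (σ≗ρ ∘ suc))

  dot-subsetSum : ∀ {d n} (c : Pt d) (G : Fin n → Pt d) σ →
    dot c (subsetSum G σ) ≡ ∑ℤ (λ i → selectℤ (σ i) (dot c (G i)))
  dot-subsetSum {n = zero} c G σ = dot-zeroʳ c
  dot-subsetSum {n = suc n} c G σ =
    trans (dot-distribʳ-⊕ c _ _) (cong₂ _+_ (dot-select (σ zero)) (dot-subsetSum c (G ∘ suc) (σ ∘ suc)))
    where
    dot-select : ∀ b → dot c (select b (G zero)) ≡ selectℤ b (dot c (G zero))
    dot-select true = refl
    dot-select false = dot-zeroʳ c

  subsetSum-updateAt : ∀ {d n} (G : Fin n → Pt d) σ j →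
    subsetSum G (updateAt σ j (λ _ → true)) ≡ G j ⊕ subsetSum G (updateAt σ j (λ _ → false))
  subsetSum-updateAt {n = suc n} G σ zero = cong (G zero ⊕_) (sym (⊕-identityˡ _))
  subsetSum-updateAt {n = suc n} G σ (suc j) = begin
    x ⊕ subsetSum (G ∘ suc) (updateAt (σ ∘ suc) j (λ _ → true))   ≡⟨ cong (x ⊕_) (subsetSum-updateAt (G ∘ suc) (σ ∘ suc) j) ⟩
    x ⊕ (G (suc j) ⊕ rest)                                         ≡⟨ ⊕-assoc x (G (suc j)) rest ⟨
    (x ⊕ G (suc j)) ⊕ rest                                         ≡⟨ cong (_⊕ rest) (⊕-comm x (G (suc j))) ⟩
    (G (suc j) ⊕ x) ⊕ rest                                         ≡⟨ ⊕-assoc (G (suc j)) x rest ⟩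
    G (suc j) ⊕ (x ⊕ rest)                                         ∎
    where
    open ≡-Reasoning
    x = select (σ zero) (G zero)
    rest = subsetSum (G ∘ suc) (updateAt (σ ∘ suc) j (λ _ → false))

  subsetSum∈subsetSums : ∀ {d} (gs : List (Pt d)) σ → subsetSum (lookup gs) σ ∈ subsetSums gs
  subsetSum∈subsetSums [] σ = here refl
  subsetSum∈subsetSums (g ∷ gs) σ with σ zero
  ... | true = ∈-++⁺ʳ (subsetSums gs) (∈-map⁺ (g ⊕_) (subsetSum∈subsetSums gs (σ ∘ suc)))
  ... | false = ∈-++⁺ˡ (subst (_∈ subsetSums gs) (sym (⊕-identityˡ _)) (subsetSum∈subsetSums gs (σ ∘ suc)))

  ∈subsetSums⇒subsetSum : ∀ {d} (gs : List (Pt d)) {w} → w ∈ subsetSums gs → ∃ λ σ → w ≡ subsetSum (lookup gs) σ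
  ∈subsetSums⇒subsetSum [] (here refl) = (λ ()) , refl
  ∈subsetSums⇒subsetSum (g ∷ gs) w∈ with ∈-++⁻ (subsetSums gs) w∈
  ... | inj₁ w∈′ with ∈subsetSums⇒subsetSum gs w∈′
  ...   | σ , refl = false Vector.∷ σ , sym (⊕-identityˡ _)
  ∈subsetSums⇒subsetSum (g ∷ gs) w∈ | inj₂ w∈′ with ∈-map⁻ (g ⊕_) w∈′
  ...   | w′ , w′∈ , refl with ∈subsetSums⇒subsetSum gs w′∈
  ...     | σ , refl = true Vector.∷ σ , refl

  bit : Bool → ℕ
  bit true = 1
  bit false = 0

  count : ∀ {n} → (Fin n → Bool) → ℕ
  count M = ∑ℕ (bit ∘ M)

  count-pos : ∀ {n} (M : Fin n → Bool) j → M j ≡ true → 0 ℕ.< count M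
  count-pos M j Mj = ℕₚ.≤-trans (ℕₚ.≤-reflexive (cong bit (sym Mj))) (term≤∑ℕ (bit ∘ M) j)

  count-mono-< : ∀ {n} (T M : Fin n → Bool) → (∀ i → T i ≡ true → M i ≡ true) →
    ∀ k → T k ≡ false → M k ≡ true → count T ℕ.< count M
  count-mono-< T M T⊆M k Tk Mk = ∑ℕ-mono-< bit-mono k (subst₂ (λ a b → bit a ℕ.< bit b) (sym Tk) (sym Mk) (s≤s z≤n))
    where
    bit-mono : ∀ i → bit (T i) ℕ.≤ bit (M i)
    bit-mono i with T i in Ti
    ... | false = z≤n
    ... | true rewrite T⊆M i Ti = s≤s z≤n

  hamming : ∀ {n} → (Fin n → Bool) → (Fin n → Bool) → ℕ
  hamming σ τ = count (λ i → σ i xor τ i)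

  hamming-triangle : ∀ {n} (σ ρ τ : Fin n → Bool) → hamming σ τ ℕ.≤ hamming σ ρ ℕ.+ hamming ρ τ
  hamming-triangle σ ρ τ = ℕₚ.≤-trans (∑ℕ-mono-≤ (λ i → triangle (σ i) (ρ i) (τ i)))
    (ℕₚ.≤-reflexive (∑ℕ-distrib-+ (λ i → bit (σ i xor ρ i)) (λ i → bit (ρ i xor τ i))))
    where
    triangle : ∀ a b c → bit (a xor c) ℕ.≤ bit (a xor b) ℕ.+ bit (b xor c)
    triangle true true c = ℕₚ.≤-refl
    triangle false false c = ℕₚ.≤-refl
    triangle true false true = z≤n
    triangle true false false = s≤s z≤n
    triangle false true true = s≤s z≤n
    triangle false true false = z≤n

  bit-xor-self : ∀ b → bit (b xor b) ≡ 0
  bit-xor-self true = refl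
  bit-xor-self false = refl

  bit-xor-≢ : ∀ {a b} → a ≢ b → bit (a xor b) ≡ 1
  bit-xor-≢ {true} {true} a≢b = ⊥-elim (a≢b refl)
  bit-xor-≢ {true} {false} a≢b = refl
  bit-xor-≢ {false} {true} a≢b = refl
  bit-xor-≢ {false} {false} a≢b = ⊥-elim (a≢b refl)

  hamming-≗ : ∀ {n} (σ τ : Fin n → Bool) → (∀ i → σ i ≡ τ i) → hamming σ τ ≡ 0
  hamming-≗ {n} σ τ σ≗τ = trans (∑ℕ-cong (λ i → cong (λ b → bit (b xor τ i)) (σ≗τ i)))
    (trans (∑ℕ-const (λ i → bit (τ i xor τ i)) 0 (λ i → bit-xor-self (τ i))) (ℕₚ.*-zeroʳ n))

  hamming≤n : ∀ {n} (σ τ : Fin n → Bool) → hamming σ τ ℕ.≤ n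
  hamming≤n {n} σ τ = ℕₚ.≤-trans (∑ℕ-bound _ 1 (λ i → bit≤1 (σ i xor τ i))) (ℕₚ.≤-reflexive (ℕₚ.*-identityʳ n))
    where
    bit≤1 : ∀ b → bit b ℕ.≤ 1
    bit≤1 true = s≤s z≤n
    bit≤1 false = z≤n

  hamming-false-true : ∀ n → hamming {n} (λ _ → false) (λ _ → true) ≡ n
  hamming-false-true n = trans (∑ℕ-const {n} (λ _ → 1) 1 (λ _ → refl)) (ℕₚ.*-identityʳ n)

  hamming-flip : ∀ {n} (σ τ : Fin n → Bool) j → σ j ≢ τ j → hamming σ τ ≡ suc (hamming (updateAt σ j not) τ)
  hamming-flip {suc n} σ τ zero σ₀≢τ₀ with σ zero | τ zero
  ... | true | true = ⊥-elim (σ₀≢τ₀ refl)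
  ... | false | false = ⊥-elim (σ₀≢τ₀ refl)
  ... | true | false = refl
  ... | false | true = refl
  hamming-flip {suc n} σ τ (suc j) σⱼ≢τⱼ =
    trans (cong (bit (σ zero xor τ zero) ℕ.+_) (hamming-flip (σ ∘ suc) (τ ∘ suc) j σⱼ≢τⱼ)) (ℕₚ.+-suc _ _)

  hamming≤1 : ∀ {n} (σ τ : Fin n → Bool) → (∀ j k → j ≢ k → σ j ≢ τ j → σ k ≢ τ k → ⊥) → hamming σ τ ℕ.≤ 1
  hamming≤1 {zero} σ τ unique = z≤n
  hamming≤1 {suc n} σ τ unique with σ zero Bool.≟ τ zero
  ... | yes σ₀≡τ₀ rewrite σ₀≡τ₀ | bit-xor-self (τ zero) =
    hamming≤1 (σ ∘ suc) (τ ∘ suc) (λ j k j≢k → unique (suc j) (suc k) (j≢k ∘ Finₚ.suc-injective))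
  ... | no σ₀≢τ₀ rewrite bit-xor-≢ σ₀≢τ₀ = s≤s (ℕₚ.≤-reflexive (hamming-≗ (σ ∘ suc) (τ ∘ suc) agree))
    where
    agree : ∀ i → σ (suc i) ≡ τ (suc i)
    agree i with σ (suc i) Bool.≟ τ (suc i)
    ... | yes σᵢ≡τᵢ = σᵢ≡τᵢ
    ... | no σᵢ≢τᵢ = ⊥-elim (unique zero (suc i) (λ ()) σ₀≢τ₀ σᵢ≢τᵢ)

  argmax : ∀ {n} {P : Fin n → Set} (R : Fin n → Fin n → Set) → (∀ i → Dec (P i)) →
    (∀ i j → R i j ⊎ R j i) → (∀ {i j k} → P j → R i j → R j k → R i k) →
    ∃ P → ∃ λ k → P k × (∀ i → P i → R i k)
  argmax {suc n} {P} R P? total trans (i₀ , Pi₀) with Finₚ.any? (P? ∘ suc)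
  ... | no none = zero , P₀ , λ { zero _ → R₀₀ ; (suc i) Pi → ⊥-elim (none (i , Pi)) }
    where
    P₀ : P zero
    P₀ = only-candidate i₀ Pi₀
      where
      only-candidate : ∀ i → P i → P zero
      only-candidate zero Pz = Pz
      only-candidate (suc i) Pi = ⊥-elim (none (i , Pi))
    R₀₀ : R zero zero
    R₀₀ = [ id , id ]′ (total zero zero)
  ... | yes some with argmax (λ i j → R (suc i) (suc j)) (P? ∘ suc) (λ i j → total (suc i) (suc j)) trans some
  ...   | k , Pk , max with P? zero
  ...     | no ¬P₀ = suc k , Pk , λ { zero P₀ → ⊥-elim (¬P₀ P₀) ; (suc i) Pi → max i Pi }
  ...     | yes P₀ with total zero (suc k)
  ...       | inj₁ R₀ₖ = suc k , Pk , λ { zero _ → R₀ₖ ; (suc i) Pi → max i Pi }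
  ...       | inj₂ Rₖ₀ = zero , P₀ , λ { zero _ → [ id , id ]′ (total zero zero) ; (suc i) Pi → trans Pk (max i Pi) Rₖ₀ }

module ListFacts where

  open import Data.Nat using (s≤s)
  open import Data.Fin as Fin using (Fin; zero; suc)
  import Data.Fin.Properties as Finₚ
  open import Data.List as List using (List; []; _∷_; lookup)
  open import Data.List.Membership.Propositional using (_∈_)
  open import Data.List.Membership.Propositional.Properties using (∈-lookup)
  open import Data.List.Membership.Propositional.Properties.WithK using (unique∧set⇒bag)
  open import Data.List.Relation.Unary.Any using (here; there)
  open import Data.List.Relation.Unary.All as All using (All; []; _∷_)
  import Data.List.Relation.Unary.All.Properties as Allₚ
  open import Data.List.Relation.Unary.AllPairs using (AllPairs; []; _∷_)
  open import Data.List.Relation.Unary.Unique.Propositional using (Unique)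
  open import Data.List.Relation.Binary.Permutation.Propositional using (_↭_)
  open import Data.List.Relation.Binary.BagAndSetEquality using (∼bag⇒↭)
  open import Data.Product using (_,_)
  open import Data.Empty using (⊥-elim)
  open import Function.Bundles using (mk⇔)
  open import Relation.Binary.Definitions using (Symmetric; tri<; tri≈; tri>)
  open import Relation.Binary.PropositionalEquality

  unique-⇔⇒↭ : ∀ {A : Set} {xs ys : List A} → Unique xs → Unique ys →
    (∀ {x} → x ∈ xs → x ∈ ys) → (∀ {x} → x ∈ ys → x ∈ xs) → xs ↭ ys
  unique-⇔⇒↭ xs! ys! xs⊆ys ys⊆xs = ∼bag⇒↭ (unique∧set⇒bag xs! ys! (mk⇔ xs⊆ys ys⊆xs))

  Unique-map⁺ : ∀ {A B : Set} (f : A → B) {xs : List A} → Unique xs →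
    (∀ {x y} → x ∈ xs → y ∈ xs → f x ≡ f y → x ≡ y) → Unique (List.map f xs)
  Unique-map⁺ f [] _ = []
  Unique-map⁺ f (x∉xs ∷ xs!) f-injective =
    Allₚ.map⁺ (All.tabulate λ y∈xs fx≡fy → All.lookup x∉xs y∈xs (f-injective (here refl) (there y∈xs) fx≡fy))
    ∷ Unique-map⁺ f xs! (λ x∈ y∈ → f-injective (there x∈) (there y∈))

  module _ {A : Set} {R : A → A → Set} where

    private
      AllPairs-lookup-< : ∀ {xs} → AllPairs R xs → ∀ i j → i Fin.< j → R (lookup xs i) (lookup xs j)
      AllPairs-lookup-< (x~xs ∷ _) zero (suc j) _ = All.lookup x~xs (∈-lookup j)
      AllPairs-lookup-< (_ ∷ pairwise) (suc i) (suc j) (s≤s i<j) = AllPairs-lookup-< pairwise i j i<j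

    AllPairs-lookup : ∀ {xs} → Symmetric R → AllPairs R xs → ∀ i j → i ≢ j → R (lookup xs i) (lookup xs j)
    AllPairs-lookup sym-R pairwise i j i≢j with Finₚ.<-cmp i j
    ... | tri< i<j _ _ = AllPairs-lookup-< pairwise i j i<j
    ... | tri≈ _ i≡j _ = ⊥-elim (i≢j i≡j)
    ... | tri> _ _ j<i = sym-R (AllPairs-lookup-< pairwise j i j<i)

    AllPairs-∈ : ∀ {xs} → Symmetric R → AllPairs R xs → ∀ {x y} → x ∈ xs → y ∈ xs → x ≢ y → R x y
    AllPairs-∈ sym-R (x~xs ∷ _) (here refl) (here refl) x≢y = ⊥-elim (x≢y refl)
    AllPairs-∈ sym-R (x~xs ∷ _) (here refl) (there y∈) _ = All.lookup x~xs y∈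
    AllPairs-∈ sym-R (x~xs ∷ _) (there x∈) (here refl) _ = sym-R (All.lookup x~xs x∈)
    AllPairs-∈ sym-R (_ ∷ pairwise) (there x∈) (there y∈) x≢y = AllPairs-∈ sym-R pairwise x∈ y∈ x≢y

  AllPairs-strengthen : ∀ {A : Set} {P : A → Set} {R S : A → A → Set} → (∀ {x y} → P x → P y → R x y → S x y) →
    ∀ {xs} → All P xs → AllPairs R xs → AllPairs S xs
  AllPairs-strengthen R⇒S [] [] = []
  AllPairs-strengthen R⇒S (px ∷ pxs) (x~xs ∷ pairwise) =
    All.zipWith (λ (py , x~y) → R⇒S px py x~y) (pxs , x~xs) ∷ AllPairs-strengthen R⇒S pxs pairwise

module PrimitivePart where

  open import Defs
  open Vectors
  open Integers using (0<-a⇒a<0)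
  open import Data.Nat as ℕ using (ℕ; zero; suc; z≤n; s≤s)
  import Data.Nat.Properties as ℕₚ
  open import Data.Nat.GCD using (gcd; gcd[m,n]∣m; gcd[m,n]∣n; c*gcd[m,n]≡gcd[cm,cn]; gcd[m,n]≡0⇒m≡0; gcd[m,n]≡0⇒n≡0)
  open import Data.Nat.Divisibility using (_∣_; divides; ∣-trans)
  open import Data.Integer as ℤ using (ℤ; +_; +[1+_]; -[1+_]; 0ℤ; -_; _*_; _<_; ∣_∣)
  import Data.Integer.Properties as ℤₚ
  open import Data.Vec using ([]; _∷_; lookup)
  open import Data.Fin using (zero; suc)
  open import Data.Product using (Σ; _×_; _,_; proj₁; proj₂)
  open import Data.Sum using (_⊎_; inj₁; inj₂; [_,_]′)
  open import Data.Empty using (⊥; ⊥-elim)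
  open import Relation.Nullary using (Dec; yes; no)
  open import Relation.Binary.Definitions using (tri<; tri≈; tri>)
  open import Relation.Binary.PropositionalEquality

  FirstNonzeroPos? : ∀ {d} (x : Pt d) → Dec (FirstNonzeroPos x)
  FirstNonzeroPos? [] = no (λ ())
  FirstNonzeroPos? (a ∷ x) with 0ℤ ℤ.<? a
  ... | yes a>0 = yes (inj₁ a>0)
  ... | no a≯0 with a ℤ.≟ 0ℤ
  ...   | no a≢0 = no λ { (inj₁ a>0) → a≯0 a>0 ; (inj₂ (a≡0 , _)) → a≢0 a≡0 }
  ...   | yes a≡0 with FirstNonzeroPos? x
  ...     | yes px = yes (inj₂ (a≡0 , px))
  ...     | no ¬px = no λ { (inj₁ a>0) → a≯0 a>0 ; (inj₂ (_ , px)) → ¬px px }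

  FirstNonzeroPos-neg-exclusive : ∀ {d} (x : Pt d) → FirstNonzeroPos x → FirstNonzeroPos (neg x) → ⊥
  FirstNonzeroPos-neg-exclusive (a ∷ x) (inj₁ a>0) (inj₁ -a>0) = ℤₚ.<-asym a>0 (0<-a⇒a<0 -a>0)
  FirstNonzeroPos-neg-exclusive (a ∷ x) (inj₁ a>0) (inj₂ (-a≡0 , _)) =
    ℤₚ.<-irrefl (sym (trans (sym (ℤₚ.neg-involutive a)) (cong -_ -a≡0))) a>0
  FirstNonzeroPos-neg-exclusive (a ∷ x) (inj₂ (refl , _)) (inj₁ -a>0) = ℤₚ.<-irrefl refl -a>0
  FirstNonzeroPos-neg-exclusive (a ∷ x) (inj₂ (_ , px)) (inj₂ (_ , p-x)) = FirstNonzeroPos-neg-exclusive x px p-x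

  FirstNonzeroPos-or-neg : ∀ {d} (x : Pt d) → x ≢ zeroV → FirstNonzeroPos x ⊎ FirstNonzeroPos (neg x)
  FirstNonzeroPos-or-neg [] x≢0 = ⊥-elim (x≢0 refl)
  FirstNonzeroPos-or-neg (a ∷ x) ax≢0 with ℤₚ.<-cmp a 0ℤ
  ... | tri> _ _ a>0 = inj₁ (inj₁ a>0)
  ... | tri< a<0 _ _ = inj₂ (inj₁ (ℤₚ.neg-mono-< a<0))
  ... | tri≈ _ refl _ with FirstNonzeroPos-or-neg x (λ x≡0 → ax≢0 (cong (0ℤ ∷_) x≡0))
  ...   | inj₁ px = inj₁ (inj₂ (refl , px))
  ...   | inj₂ p-x = inj₂ (inj₂ (refl , p-x))

  orient : ∀ {d} → Pt d → Pt d
  orient x with FirstNonzeroPos? x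
  ... | yes _ = x
  ... | no _ = neg x

  orient-≡-or-neg : ∀ {d} (x : Pt d) → orient x ≡ x ⊎ orient x ≡ neg x
  orient-≡-or-neg x with FirstNonzeroPos? x
  ... | yes _ = inj₁ refl
  ... | no _ = inj₂ refl

  orient-FirstNonzeroPos : ∀ {d} (x : Pt d) → x ≢ zeroV → FirstNonzeroPos (orient x)
  orient-FirstNonzeroPos x x≢0 with FirstNonzeroPos? x
  ... | yes px = px
  ... | no ¬px = [ (λ px → ⊥-elim (¬px px)) , (λ p-x → p-x) ]′ (FirstNonzeroPos-or-neg x x≢0)

  orient-id : ∀ {d} (x : Pt d) → FirstNonzeroPos x → orient x ≡ x
  orient-id x px with FirstNonzeroPos? x
  ... | yes _ = refl
  ... | no ¬px = ⊥-elim (¬px px)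

  orient-neg : ∀ {d} (x : Pt d) → FirstNonzeroPos x → orient (neg x) ≡ x
  orient-neg x px with FirstNonzeroPos? (neg x)
  ... | yes p-x = ⊥-elim (FirstNonzeroPos-neg-exclusive x px p-x)
  ... | no _ = neg-involutive x

  orient-≡⇒≡-or-neg : ∀ {d} (x y : Pt d) → orient x ≡ orient y → x ≡ y ⊎ x ≡ neg y
  orient-≡⇒≡-or-neg x y e with orient-≡-or-neg x | orient-≡-or-neg y
  ... | inj₁ ex | inj₁ ey = inj₁ (trans (sym ex) (trans e ey))
  ... | inj₁ ex | inj₂ ey = inj₂ (trans (sym ex) (trans e ey))
  ... | inj₂ ex | inj₁ ey = inj₂ (trans (sym (neg-involutive x)) (cong neg (trans (sym ex) (trans e ey))))
  ... | inj₂ ex | inj₂ ey = inj₁ (trans (sym (neg-involutive x)) (trans (cong neg (trans (sym ex) (trans e ey))) (neg-involutive y)))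

  l1-neg : ∀ {d} (x : Pt d) → l1 (neg x) ≡ l1 x
  l1-neg [] = refl
  l1-neg (a ∷ x) = cong₂ ℕ._+_ (ℤₚ.∣-i∣≡∣i∣ a) (l1-neg x)

  l1-scale : ∀ {d} k (x : Pt d) → l1 (scale k x) ≡ ∣ k ∣ ℕ.* l1 x
  l1-scale k [] = sym (ℕₚ.*-zeroʳ ∣ k ∣)
  l1-scale k (a ∷ x) = trans (cong₂ ℕ._+_ (ℤₚ.abs-* k a) (l1-scale k x)) (sym (ℕₚ.*-distribˡ-+ ∣ k ∣ ∣ a ∣ (l1 x)))

  l1≡0⇒≡zeroV : ∀ {d} (x : Pt d) → l1 x ≡ 0 → x ≡ zeroV
  l1≡0⇒≡zeroV [] e = refl
  l1≡0⇒≡zeroV (a ∷ x) e = cong₂ _∷_ (ℤₚ.∣i∣≡0⇒i≡0 (ℕₚ.m+n≡0⇒m≡0 _ e)) (l1≡0⇒≡zeroV x (ℕₚ.m+n≡0⇒n≡0 ∣ a ∣ e))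

  l1-pos : ∀ {d} (x : Pt d) → x ≢ zeroV → 0 ℕ.< l1 x
  l1-pos x x≢0 with l1 x in e
  ... | zero = ⊥-elim (x≢0 (l1≡0⇒≡zeroV x e))
  ... | suc _ = s≤s z≤n

  vgcd-scale : ∀ {d} k (x : Pt d) → vgcd (scale k x) ≡ ∣ k ∣ ℕ.* vgcd x
  vgcd-scale k [] = sym (ℕₚ.*-zeroʳ ∣ k ∣)
  vgcd-scale k (a ∷ x) = trans (cong₂ gcd (ℤₚ.abs-* k a) (vgcd-scale k x)) (sym (c*gcd[m,n]≡gcd[cm,cn] ∣ k ∣ ∣ a ∣ (vgcd x)))

  vgcd-neg : ∀ {d} (x : Pt d) → vgcd (neg x) ≡ vgcd x
  vgcd-neg x = trans (cong vgcd (sym (scale-[-1]≡neg x))) (trans (vgcd-scale -[1+ 0 ] x) (ℕₚ.*-identityˡ (vgcd x)))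

  vgcd∣lookup : ∀ {d} (x : Pt d) i → vgcd x ∣ ∣ lookup x i ∣
  vgcd∣lookup (a ∷ x) zero = gcd[m,n]∣m ∣ a ∣ (vgcd x)
  vgcd∣lookup (a ∷ x) (suc i) = ∣-trans (gcd[m,n]∣n ∣ a ∣ (vgcd x)) (vgcd∣lookup x i)

  vgcd≡0⇒≡zeroV : ∀ {d} (x : Pt d) → vgcd x ≡ 0 → x ≡ zeroV
  vgcd≡0⇒≡zeroV [] e = refl
  vgcd≡0⇒≡zeroV (a ∷ x) e = cong₂ _∷_ (ℤₚ.∣i∣≡0⇒i≡0 (gcd[m,n]≡0⇒m≡0 e)) (vgcd≡0⇒≡zeroV x (gcd[m,n]≡0⇒n≡0 ∣ a ∣ e))

  divide : ∀ {d} q (x : Pt d) → (∀ i → q ∣ ∣ lookup x i ∣) → Σ (Pt d) λ y → scale (+ q) y ≡ x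
  divide q [] q∣x = [] , refl
  divide q (a ∷ x) q∣x with divide-ℤ a (q∣x zero) | divide q x (λ i → q∣x (suc i))
    where
    divide-ℤ : ∀ z → q ∣ ∣ z ∣ → Σ ℤ λ w → + q * w ≡ z
    divide-ℤ (+ m) (divides k e) = + k , trans (sym (ℤₚ.pos-* q k)) (cong +_ (trans (ℕₚ.*-comm q k) (sym e)))
    divide-ℤ -[1+ m ] (divides k e) = - (+ k) ,
      trans (sym (ℤₚ.neg-distribʳ-* (+ q) (+ k))) (cong -_ (trans (sym (ℤₚ.pos-* q k)) (cong +_ (trans (ℕₚ.*-comm q k) (sym e)))))
  ... | w , qw≡a | y , qy≡x = w ∷ y , cong₂ _∷_ qw≡a qy≡x

  content-free : ∀ {d} → Pt d → Pt d
  content-free x = proj₁ (divide (vgcd x) x (vgcd∣lookup x))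

  content-free-scale : ∀ {d} (x : Pt d) → scale (+ vgcd x) (content-free x) ≡ x
  content-free-scale x = proj₂ (divide (vgcd x) x (vgcd∣lookup x))

  prim : ∀ {d} → Pt d → Pt d
  prim x = orient (content-free x)

  module _ {d} (x : Pt d) (x≢0 : x ≢ zeroV) where

    private
      vgcd≢0 : vgcd x ≢ 0
      vgcd≢0 e = x≢0 (vgcd≡0⇒≡zeroV x e)

      prim-multiple : Σ ℤ λ s → (s ≢ 0ℤ) × (scale s (prim x) ≡ x) × (∣ s ∣ ≡ vgcd x)
      prim-multiple with orient-≡-or-neg (content-free x)
      ... | inj₁ e = + vgcd x , +q≢0 , trans (cong (scale (+ vgcd x)) e) (content-free-scale x) , refl
        where
        +q≢0 : + vgcd x ≢ 0ℤ
        +q≢0 e = vgcd≢0 (ℤₚ.+-injective e)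
      ... | inj₂ e = - (+ vgcd x) , -q≢0 , trans (cong (scale (- (+ vgcd x))) e) (begin
          scale (- (+ vgcd x)) (neg y)  ≡⟨ scale-neg (+ vgcd x) (neg y) ⟩
          scale (+ vgcd x) (neg (neg y)) ≡⟨ cong (scale (+ vgcd x)) (neg-involutive y) ⟩
          scale (+ vgcd x) y            ≡⟨ content-free-scale x ⟩
          x                             ∎) , ℤₚ.∣-i∣≡∣i∣ (+ vgcd x)
        where
        open ≡-Reasoning
        y = content-free x
        -q≢0 : - (+ vgcd x) ≢ 0ℤ
        -q≢0 e = vgcd≢0 (ℤₚ.+-injective (trans (sym (ℤₚ.neg-involutive _)) (cong -_ e)))

    prim-factor : ℤ
    prim-factor = proj₁ prim-multiple

    prim-factor-≢0 : prim-factor ≢ 0ℤ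
    prim-factor-≢0 = proj₁ (proj₂ prim-multiple)

    prim-factor-scale : scale prim-factor (prim x) ≡ x
    prim-factor-scale = proj₁ (proj₂ (proj₂ prim-multiple))

    ∣prim-factor∣ : ∣ prim-factor ∣ ≡ vgcd x
    ∣prim-factor∣ = proj₂ (proj₂ (proj₂ prim-multiple))

    prim-≢zeroV : prim x ≢ zeroV
    prim-≢zeroV e = x≢0 (trans (sym prim-factor-scale) (trans (cong (scale prim-factor) e) (scale-zeroʳ prim-factor)))

    vgcd-prim : vgcd (prim x) ≡ 1
    vgcd-prim = ℕₚ.*-cancelˡ-≡ (vgcd (prim x)) 1 (vgcd x) {{ℕ.≢-nonZero vgcd≢0}} (begin
      vgcd x ℕ.* vgcd (prim x)  ≡⟨ cong (ℕ._* vgcd (prim x)) ∣prim-factor∣ ⟨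
      ∣ prim-factor ∣ ℕ.* vgcd (prim x)   ≡⟨ vgcd-scale prim-factor (prim x) ⟨
      vgcd (scale prim-factor (prim x))   ≡⟨ cong vgcd prim-factor-scale ⟩
      vgcd x                    ≡⟨ ℕₚ.*-identityʳ (vgcd x) ⟨
      vgcd x ℕ.* 1              ∎)
      where open ≡-Reasoning

    prim-FirstNonzeroPos : FirstNonzeroPos (prim x)
    prim-FirstNonzeroPos = orient-FirstNonzeroPos (content-free x) content-free-≢zeroV
      where
      content-free-≢zeroV : content-free x ≢ zeroV
      content-free-≢zeroV e = x≢0 (trans (sym (content-free-scale x)) (trans (cong (scale (+ vgcd x)) e) (scale-zeroʳ (+ vgcd x))))

    l1-prim : l1 x ≡ vgcd x ℕ.* l1 (prim x)
    l1-prim = trans (cong l1 (sym prim-factor-scale)) (trans (l1-scale prim-factor (prim x)) (cong (ℕ._* l1 (prim x)) ∣prim-factor∣))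

    l1-prim≤l1 : l1 (prim x) ℕ.≤ l1 x
    l1-prim≤l1 = ℕₚ.≤-trans (ℕₚ.m≤n*m (l1 (prim x)) (vgcd x) {{ℕ.≢-nonZero vgcd≢0}}) (ℕₚ.≤-reflexive (sym l1-prim))

    l1-prim≡l1⇒≡±prim : l1 x ≡ l1 (prim x) → x ≡ prim x ⊎ x ≡ neg (prim x)
    l1-prim≡l1⇒≡±prim e with prim-factor≡±1
      where
      vgcd≡1 : vgcd x ≡ 1
      vgcd≡1 = ℕₚ.*-cancelʳ-≡ (vgcd x) 1 (l1 (prim x)) {{ℕ.>-nonZero (l1-pos (prim x) prim-≢zeroV)}}
        (trans (sym l1-prim) (trans e (sym (ℕₚ.*-identityˡ _))))
      prim-factor≡±1 : prim-factor ≡ + 1 ⊎ prim-factor ≡ -[1+ 0 ]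
      prim-factor≡±1 = unit-abs prim-factor (trans ∣prim-factor∣ vgcd≡1)
        where
        unit-abs : ∀ s → ∣ s ∣ ≡ 1 → s ≡ + 1 ⊎ s ≡ -[1+ 0 ]
        unit-abs +[1+ 0 ] _ = inj₁ refl
        unit-abs -[1+ 0 ] _ = inj₂ refl
        unit-abs (+ 0) ()
        unit-abs +[1+ suc n ] ()
        unit-abs -[1+ suc n ] ()
    ... | inj₁ factor≡1 = inj₁ (trans (sym prim-factor-scale) (trans (cong (λ k → scale k (prim x)) factor≡1) (scale-identityˡ (prim x))))
    ... | inj₂ factor≡-1 = inj₂ (trans (sym prim-factor-scale) (trans (cong (λ k → scale k (prim x)) factor≡-1) (scale-[-1]≡neg (prim x))))

  prim-≡⇒collinear : ∀ {d} (x z : Pt d) → x ≢ zeroV → z ≢ zeroV → prim x ≡ prim z → Collinear x z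
  prim-≡⇒collinear x z x≢0 z≢0 e = r , s , inj₁ (prim-factor-≢0 z z≢0) , (begin
    scale r x                   ≡⟨ cong (scale r) s·px≡x ⟨
    scale r (scale s (prim x))  ≡⟨ scale-comm r s (prim x) ⟩
    scale s (scale r (prim x))  ≡⟨ cong (λ y → scale s (scale r y)) e ⟩
    scale s (scale r (prim z))  ≡⟨ cong (scale s) r·pz≡z ⟩
    scale s z                   ∎)
    where
    open ≡-Reasoning
    s = prim-factor x x≢0
    r = prim-factor z z≢0
    s·px≡x = prim-factor-scale x x≢0
    r·pz≡z = prim-factor-scale z z≢0

  IsH1Gen-prim : ∀ {d} p (x : Pt d) → x ≢ zeroV → l1 (prim x) ℕ.≤ p → IsH1Gen p (prim x)
  IsH1Gen-prim p x x≢0 small = (prim-≢zeroV x x≢0 , vgcd-prim x x≢0) , small , prim-FirstNonzeroPos x x≢0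

  -- Collinear primitive vectors agree up to sign, and the sign is fixed by the first nonzero coordinate.
  H1Gen-collinear⇒≡ : ∀ {d} p (x z : Pt d) → IsH1Gen p x → IsH1Gen p z → Collinear x z → x ≡ z
  H1Gen-collinear⇒≡ p x z ((x≢0 , vgcd-x) , _ , px) ((z≢0 , vgcd-z) , _ , pz) (a , b , a≢0∨b≢0 , ax≡bz)
    with same-abs a b ∣a∣≡∣b∣
    where
    ∣a∣≡∣b∣ : ∣ a ∣ ≡ ∣ b ∣
    ∣a∣≡∣b∣ = begin
      ∣ a ∣                ≡⟨ ℕₚ.*-identityʳ ∣ a ∣ ⟨
      ∣ a ∣ ℕ.* 1          ≡⟨ cong (∣ a ∣ ℕ.*_) vgcd-x ⟨
      ∣ a ∣ ℕ.* vgcd x     ≡⟨ vgcd-scale a x ⟨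
      vgcd (scale a x)     ≡⟨ cong vgcd ax≡bz ⟩
      vgcd (scale b z)     ≡⟨ vgcd-scale b z ⟩
      ∣ b ∣ ℕ.* vgcd z     ≡⟨ cong (∣ b ∣ ℕ.*_) vgcd-z ⟩
      ∣ b ∣ ℕ.* 1          ≡⟨ ℕₚ.*-identityʳ ∣ b ∣ ⟩
      ∣ b ∣                ∎
      where open ≡-Reasoning
    same-abs : ∀ a b → ∣ a ∣ ≡ ∣ b ∣ → a ≡ b ⊎ a ≡ - b
    same-abs (+ m) (+ .m) refl = inj₁ refl
    same-abs +[1+ m ] -[1+ .m ] refl = inj₂ refl
    same-abs -[1+ m ] +[1+ .m ] refl = inj₂ refl
    same-abs -[1+ m ] -[1+ .m ] refl = inj₁ refl
    same-abs (+ 0) -[1+ n ] ()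
    same-abs -[1+ m ] (+ 0) ()
  ... | inj₁ refl = scale-cancelˡ a x z a≢0 ax≡bz
    where
    a≢0 : a ≢ 0ℤ
    a≢0 refl = [ (λ a≢0 → a≢0 refl) , (λ b≢0 → b≢0 refl) ]′ a≢0∨b≢0
  ... | inj₂ refl = ⊥-elim (FirstNonzeroPos-neg-exclusive x px (subst FirstNonzeroPos (sym neg-x≡z) pz))
    where
    b≢0 : b ≢ 0ℤ
    b≢0 refl = [ (λ a≢0 → a≢0 refl) , (λ b≢0 → b≢0 refl) ]′ a≢0∨b≢0
    neg-x≡z : neg x ≡ z
    neg-x≡z = scale-cancelˡ b (neg x) z b≢0 (trans (sym (scale-neg b x)) ax≡bz)

module GeneratorExchange where

  open import Defs
  open Vectors using (_≟ᵥ_)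
  open PrimitivePart
  open import Data.Nat using (ℕ; zero; suc; _+_; _*_; _∸_; _≤_; _<_; s≤s)
  import Data.Nat.Properties as ℕₚ
  open import Data.Nat.ListAction using (sum)
  open import Data.Nat.ListAction.Properties using (sum-↭)
  open import Data.Nat.Tactic.RingSolver using (solve-∀)
  open import Data.List as List using (List; []; _∷_; length)
  open import Data.List.Membership.Propositional using (_∈_)
  open import Data.List.Membership.Propositional.Properties using (∈-∃++)
  open import Data.List.Relation.Unary.Any using (here; there; any?)
  open import Data.List.Relation.Unary.All as All using (All; []; _∷_)
  open import Data.List.Relation.Unary.AllPairs using (AllPairs; []; _∷_)
  open import Data.List.Relation.Binary.Permutation.Propositional using (_↭_; ↭-sym)
  open import Data.List.Relation.Binary.Permutation.Propositional.Properties using (shift; map⁺; ↭-length; ∈-resp-↭)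
  open import Data.Product using (∃; _×_; _,_; proj₁; proj₂)
  open import Data.Empty using (⊥; ⊥-elim)
  open import Relation.Nullary using (¬_; yes; no)
  open import Function using (_∘_)
  open import Relation.Binary.PropositionalEquality

  l1Sum : ∀ {d} → List (Pt d) → ℕ
  l1Sum gs = sum (List.map l1 gs)

  ∈⇒↭∷ : ∀ {A : Set} {v : A} {xs} → v ∈ xs → ∃ λ rest → xs ↭ v ∷ rest
  ∈⇒↭∷ v∈xs with ∈-∃++ v∈xs
  ... | ys , zs , refl = _ , shift _ ys zs

  Matching : ∀ {d} → List (Pt d) → List (Pt d) → Set
  Matching Zs Hs = (∀ {g} → g ∈ Zs → prim g ∈ Hs × l1 g ≡ l1 (prim g)) × (∀ {x} → x ∈ Hs → ∃ λ g → g ∈ Zs × prim g ≡ x)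

  -- Bookkeeping for matching each g ∈ Zs with prim g ∈ Hs: unmatched counts the members of Hs not
  -- of the form prim g, outside the g with prim g ∉ Hs, and excess collects the ℓ¹-length that the
  -- generators g spend beyond ‖prim g‖₁ (matched) or p + 1 (outside), plus p − ‖x‖₁ for unmatched x.
  record Exchange {d} (p : ℕ) (Zs Hs : List (Pt d)) : Set where
    field
      unmatched outside excess : ℕ
      balance : l1Sum Hs + length Zs * suc p + unmatched + excess ≡ l1Sum Zs + length Hs * suc p
      counting : length Zs + unmatched ≡ length Hs + outside
      tight : unmatched ≡ 0 → outside ≡ 0 → excess ≡ 0 → Matching Zs Hs

  private
    balance-matched : ∀ {A n s u e B N A′ N′ b} x Q → A′ ≡ x + A → N′ ≡ suc N → x + Q ≡ b →
      A + n * s + u + e ≡ B + N * s → A′ + suc n * s + u + (e + Q) ≡ (b + B) + N′ * s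
    balance-matched {A} {n} {s} {u} {e} {B} {N} x Q refl refl refl ih = begin
      (x + A) + (s + n * s) + u + (e + Q)  ≡⟨ regroupˡ x A n s u e Q ⟩
      (x + Q + s) + (A + n * s + u + e)    ≡⟨ cong (x + Q + s +_) ih ⟩
      (x + Q + s) + (B + N * s)            ≡⟨ regroupʳ x Q s B N ⟩
      (x + Q + B) + (s + N * s)            ∎
      where
      open ≡-Reasoning
      regroupˡ : ∀ x A n s u e Q → (x + A) + (s + n * s) + u + (e + Q) ≡ (x + Q + s) + (A + n * s + u + e)
      regroupˡ = solve-∀
      regroupʳ : ∀ x Q s B N → (x + Q + s) + (B + N * s) ≡ (x + Q + B) + (s + N * s)
      regroupʳ = solve-∀

    balance-unmatched : ∀ {A n s u e B N b} Q → s + Q ≡ b →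
      A + n * s + u + e ≡ B + N * s → A + suc n * s + u + (e + Q) ≡ (b + B) + N * s
    balance-unmatched {A} {n} {s} {u} {e} {B} {N} Q refl ih = begin
      A + (s + n * s) + u + (e + Q)  ≡⟨ regroup A n s u e Q ⟩
      (s + Q) + (A + n * s + u + e)  ≡⟨ cong (s + Q +_) ih ⟩
      (s + Q) + (B + N * s)          ≡⟨ ℕₚ.+-assoc (s + Q) B (N * s) ⟨
      (s + Q + B) + N * s            ∎
      where
      open ≡-Reasoning
      regroup : ∀ A n s u e Q → A + (s + n * s) + u + (e + Q) ≡ (s + Q) + (A + n * s + u + e)
      regroup = solve-∀

  module _ {d : ℕ} (p : ℕ) where

    private
      slack : List (Pt d) → ℕ
      slack Hs = sum (List.map (λ x → p ∸ l1 x) Hs)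

      count-with-slack : ∀ (Hs : List (Pt d)) → (∀ {x} → x ∈ Hs → l1 x ≤ p) →
        l1Sum Hs + length Hs + slack Hs ≡ length Hs * suc p
      count-with-slack [] _ = refl
      count-with-slack (x ∷ Hs) short = begin
        (l1 x + l1Sum Hs) + suc (length Hs) + ((p ∸ l1 x) + slack Hs)
          ≡⟨ regroup (l1 x) (l1Sum Hs) (length Hs) (p ∸ l1 x) (slack Hs) ⟩
        suc ((l1 x + (p ∸ l1 x)) + (l1Sum Hs + length Hs + slack Hs))
          ≡⟨ cong₂ (λ a b → suc (a + b)) (ℕₚ.m+[n∸m]≡n (short (here refl))) (count-with-slack Hs (short ∘ there)) ⟩
        suc (p + length Hs * suc p) ∎
        where
        open ≡-Reasoning
        regroup : ∀ a b c e f → (a + b) + suc c + (e + f) ≡ suc ((a + e) + (b + c + f))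
        regroup = solve-∀

    exchange-[] : ∀ (Hs : List (Pt d)) → (∀ {x} → x ∈ Hs → l1 x ≤ p) → Exchange p [] Hs
    exchange-[] Hs short = record
      { unmatched = length Hs ; outside = 0 ; excess = slack Hs
      ; balance = trans (cong (λ a → a + length Hs + slack Hs) (ℕₚ.+-identityʳ (l1Sum Hs))) (count-with-slack Hs short)
      ; counting = sym (ℕₚ.+-identityʳ (length Hs))
      ; tight = λ Hs-empty _ _ → (λ ()) , λ x∈Hs → ⊥-elim (nonempty Hs-empty x∈Hs) }
      where
      nonempty : ∀ {Hs : List (Pt d)} {x} → length Hs ≡ 0 → x ∈ Hs → ⊥
      nonempty {_ ∷ _} () _

    exchange-matched : ∀ {g : Pt d} {Zs Hs rest} → g ≢ zeroV → prim g ∈ Hs → Hs ↭ prim g ∷ rest →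
      Exchange p Zs rest → Exchange p (g ∷ Zs) Hs
    exchange-matched {g} {Zs} {Hs} {rest} g≢0 pg∈Hs Hs↭ E = record
      { unmatched = E.unmatched ; outside = E.outside ; excess = E.excess + Q
      ; balance = balance-matched {A = l1Sum rest} {n = length Zs} {N = length rest}
                    (l1 (prim g)) Q (sum-↭ (map⁺ l1 Hs↭)) (↭-length Hs↭) l1-split E.balance
      ; counting = trans (cong suc E.counting) (cong (_+ E.outside) (sym (↭-length Hs↭)))
      ; tight = tight }
      where
      module E = Exchange E
      Q = l1 g ∸ l1 (prim g)
      l1-split : l1 (prim g) + Q ≡ l1 g
      l1-split = ℕₚ.m+[n∸m]≡n (l1-prim≤l1 g g≢0)
      tight : E.unmatched ≡ 0 → E.outside ≡ 0 → E.excess + Q ≡ 0 → Matching (g ∷ Zs) Hs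
      tight u≡0 o≡0 eQ≡0 = forward , backward
        where
        matching = E.tight u≡0 o≡0 (ℕₚ.m+n≡0⇒m≡0 E.excess eQ≡0)
        l1-g : l1 g ≡ l1 (prim g)
        l1-g = trans (sym l1-split) (trans (cong (l1 (prim g) +_) (ℕₚ.m+n≡0⇒n≡0 E.excess eQ≡0)) (ℕₚ.+-identityʳ _))
        forward : ∀ {g′} → g′ ∈ g ∷ Zs → prim g′ ∈ Hs × l1 g′ ≡ l1 (prim g′)
        forward (here refl) = pg∈Hs , l1-g
        forward (there g′∈Zs) = ∈-resp-↭ (↭-sym Hs↭) (there (proj₁ (proj₁ matching g′∈Zs))) , proj₂ (proj₁ matching g′∈Zs)
        backward : ∀ {x} → x ∈ Hs → ∃ λ g′ → g′ ∈ g ∷ Zs × prim g′ ≡ x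
        backward x∈Hs with ∈-resp-↭ Hs↭ x∈Hs
        ... | here refl = g , here refl , refl
        ... | there x∈rest with proj₂ matching x∈rest
        ...   | g′ , g′∈Zs , pg′≡x = g′ , there g′∈Zs , pg′≡x

    exchange-unmatched : ∀ {g : Pt d} {Zs Hs} → suc p ≤ l1 g → Exchange p Zs Hs → Exchange p (g ∷ Zs) Hs
    exchange-unmatched {g} {Zs} {Hs} long E = record
      { unmatched = E.unmatched ; outside = suc E.outside ; excess = E.excess + (l1 g ∸ suc p)
      ; balance = balance-unmatched {A = l1Sum Hs} {n = length Zs} {N = length Hs} (l1 g ∸ suc p) (ℕₚ.m+[n∸m]≡n long) E.balance
      ; counting = trans (cong suc E.counting) (sym (ℕₚ.+-suc _ _))
      ; tight = λ { _ () _ } }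
      where module E = Exchange E

    exchange : ∀ (Zs Hs : List (Pt d)) →
      All (λ g → g ≢ zeroV) Zs → AllPairs (λ g h → ¬ Collinear g h) Zs →
      (∀ {x} → x ∈ Hs → l1 x ≤ p) → (∀ {g} → g ∈ Zs → l1 (prim g) ≤ p → prim g ∈ Hs) →
      Exchange p Zs Hs
    exchange [] Hs _ _ short _ = exchange-[] Hs short
    exchange (g ∷ Zs) Hs (g≢0 ∷ Zs≢0) (g∦Zs ∷ Zs-pairwise) short hits with any? (prim g ≟ᵥ_) Hs
    ... | no pg∉Hs = exchange-unmatched long (exchange Zs Hs Zs≢0 Zs-pairwise short (hits ∘ there))
      where
      long : suc p ≤ l1 g
      long = ℕₚ.≤-trans (ℕₚ.≰⇒> (λ small → pg∉Hs (hits (here refl) small))) (l1-prim≤l1 g g≢0)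
    ... | yes pg∈Hs with ∈⇒↭∷ pg∈Hs
    ...   | rest , Hs↭ = exchange-matched g≢0 pg∈Hs Hs↭ (exchange Zs rest Zs≢0 Zs-pairwise (short ∘ ∈rest⇒∈Hs) hits-rest)
      where
      ∈rest⇒∈Hs : ∀ {x} → x ∈ rest → x ∈ Hs
      ∈rest⇒∈Hs = ∈-resp-↭ (↭-sym Hs↭) ∘ there
      -- prim g is used up by g: no other generator has the same primitive direction.
      hits-rest : ∀ {g′} → g′ ∈ Zs → l1 (prim g′) ≤ p → prim g′ ∈ rest
      hits-rest g′∈Zs small with ∈-resp-↭ Hs↭ (hits (there g′∈Zs) small)
      ... | here pg′≡pg = ⊥-elim (All.lookup g∦Zs g′∈Zs (prim-≡⇒collinear g _ g≢0 (All.lookup Zs≢0 g′∈Zs) (sym pg′≡pg)))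
      ... | there pg′∈rest = pg′∈rest

  module _ {d} {p : ℕ} {Zs Hs : List (Pt d)} (X : Exchange p Zs Hs) where

    open Exchange X

    private
      A B n N s : ℕ
      A = l1Sum Hs
      B = l1Sum Zs
      n = length Zs
      N = length Hs
      s = suc p

      A+ns≤B+Ns : A + n * s ≤ B + N * s
      A+ns≤B+Ns = ℕₚ.≤-trans (ℕₚ.≤-trans (ℕₚ.m≤m+n _ unmatched) (ℕₚ.m≤m+n _ excess)) (ℕₚ.≤-reflexive balance)

    exchange-≤ : N ≤ n → A ≤ B
    exchange-≤ N≤n = ℕₚ.+-cancelʳ-≤ (n * s) A B (ℕₚ.≤-trans A+ns≤B+Ns (ℕₚ.+-monoʳ-≤ B (ℕₚ.*-monoˡ-≤ s N≤n)))

    exchange-< : N < n → A < B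
    exchange-< N<n = ℕₚ.+-cancelʳ-≤ (N * s) (suc A) B (begin
      suc A + N * s        ≤⟨ ℕₚ.+-monoˡ-≤ (N * s) (s≤s (ℕₚ.m≤m+n A p)) ⟩
      suc (A + p) + N * s  ≡⟨ cong (_+ N * s) (ℕₚ.+-suc A p) ⟨
      A + s + N * s        ≡⟨ ℕₚ.+-assoc A s (N * s) ⟩
      A + suc N * s        ≤⟨ ℕₚ.+-monoʳ-≤ A (ℕₚ.*-monoˡ-≤ s N<n) ⟩
      A + n * s            ≤⟨ A+ns≤B+Ns ⟩
      B + N * s            ∎)
      where open ℕₚ.≤-Reasoning

    exchange-tight : N ≤ n → B ≤ A → Matching Zs Hs
    exchange-tight N≤n B≤A = tight unmatched≡0 outside≡0 excess≡0
      where
      open ℕₚ.≤-Reasoning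
      slack≤0 : unmatched + excess ≤ 0
      slack≤0 = ℕₚ.+-cancelˡ-≤ (A + n * s) (unmatched + excess) 0 (begin
        A + n * s + (unmatched + excess)  ≡⟨ ℕₚ.+-assoc (A + n * s) unmatched excess ⟨
        A + n * s + unmatched + excess    ≡⟨ balance ⟩
        B + N * s                         ≤⟨ ℕₚ.+-mono-≤ B≤A (ℕₚ.*-monoˡ-≤ s N≤n) ⟩
        A + n * s                         ≡⟨ ℕₚ.+-identityʳ _ ⟨
        A + n * s + 0                     ∎)
      unmatched≡0 = ℕₚ.n≤0⇒n≡0 (ℕₚ.≤-trans (ℕₚ.m≤m+n unmatched excess) slack≤0)
      excess≡0 = ℕₚ.n≤0⇒n≡0 (ℕₚ.≤-trans (ℕₚ.m≤n+m excess unmatched) slack≤0)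
      n≤N : n ≤ N
      n≤N = ℕₚ.*-cancelʳ-≤ n N s (ℕₚ.+-cancelˡ-≤ A (n * s) (N * s) (begin
        A + n * s                          ≡⟨ trans (ℕₚ.+-identityʳ _) (ℕₚ.+-identityʳ _) ⟨
        A + n * s + 0 + 0                  ≡⟨ cong₂ (λ u e → A + n * s + u + e) unmatched≡0 excess≡0 ⟨
        A + n * s + unmatched + excess     ≡⟨ balance ⟩
        B + N * s                          ≤⟨ ℕₚ.+-monoˡ-≤ (N * s) B≤A ⟩
        A + N * s                          ∎))
      outside≡0 : outside ≡ 0
      outside≡0 = ℕₚ.+-cancelˡ-≡ N outside 0 (begin-equality
        N + outside      ≡⟨ counting ⟨
        n + unmatched    ≡⟨ cong₂ _+_ (ℕₚ.≤-antisym n≤N N≤n) unmatched≡0 ⟩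
        N + 0            ∎)

module Symmetry where

  open import Defs
  open Vectors
  open PrimitivePart
  open ListFacts using (unique-⇔⇒↭; Unique-map⁺)
  open import Data.Nat as ℕ using (ℕ; zero; suc)
  import Data.Nat.Properties as ℕₚ
  open import Data.Nat.GCD using (gcd; gcd-assoc; gcd-comm; gcd-identityˡ; gcd-identityʳ)
  open import Data.Nat.ListAction using (sum)
  open import Data.Nat.ListAction.Properties using (sum-↭)
  open import Data.Integer using (ℤ; ∣_∣)
  import Data.Integer.Properties as ℤₚ
  open import Data.Vec using ([]; _∷_; lookup; _∷ʳ_)
  import Data.Vec.Properties as Vecₚ
  open import Data.Fin using (Fin; zero; suc; inject₁; toℕ)
  import Data.Fin.Properties as Finₚ
  open import Data.List as List using (List)
  import Data.List.Properties as Listₚ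
  open import Data.List.Membership.Propositional using (_∈_)
  open import Data.List.Membership.Propositional.Properties using (∈-map⁺; ∈-map⁻)
  open import Data.List.Relation.Unary.Unique.Propositional using (Unique)
  open import Data.List.Relation.Binary.Permutation.Propositional using (_↭_)
  open import Data.List.Relation.Binary.Permutation.Propositional.Properties using (map⁺)
  open import Data.Product using (Σ; _×_; _,_)
  open import Data.Sum using (inj₁; inj₂)
  open import Data.Empty using (⊥-elim)
  open import Function.Bundles using (_⇔_; Equivalence)
  open import Relation.Binary.PropositionalEquality

  columnSum : ∀ {d} → Fin d → List (Pt d) → ℕ
  columnSum i gs = sum (List.map (λ x → ∣ lookup x i ∣) gs)

  rotateˡ : ∀ {d} → Pt (suc d) → Pt (suc d)
  rotateˡ (x ∷ xs) = xs ∷ʳ x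

  private
    lastV : ∀ {d} → Pt (suc d) → ℤ
    lastV (x ∷ []) = x
    lastV (x ∷ y ∷ ys) = lastV (y ∷ ys)

    initV : ∀ {d} → Pt (suc d) → Pt d
    initV (x ∷ []) = []
    initV (x ∷ y ∷ ys) = x ∷ initV (y ∷ ys)

    initV-∷ʳ-lastV : ∀ {d} (xs : Pt (suc d)) → initV xs ∷ʳ lastV xs ≡ xs
    initV-∷ʳ-lastV (x ∷ []) = refl
    initV-∷ʳ-lastV (x ∷ y ∷ ys) = cong (x ∷_) (initV-∷ʳ-lastV (y ∷ ys))

    lookup-∷ʳ : ∀ {d} (xs : Pt d) y (a : Fin d) → lookup (xs ∷ʳ y) (inject₁ a) ≡ lookup xs a
    lookup-∷ʳ (x ∷ xs) y zero = refl
    lookup-∷ʳ (x ∷ xs) y (suc a) = lookup-∷ʳ xs y a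

    l1-∷ʳ : ∀ {d} (xs : Pt d) y → l1 (xs ∷ʳ y) ≡ l1 xs ℕ.+ ∣ y ∣
    l1-∷ʳ [] y = ℕₚ.+-identityʳ ∣ y ∣
    l1-∷ʳ (x ∷ xs) y = trans (cong (∣ x ∣ ℕ.+_) (l1-∷ʳ xs y)) (sym (ℕₚ.+-assoc (∣ x ∣) (l1 xs) (∣ y ∣)))

    vgcd-∷ʳ : ∀ {d} (xs : Pt d) y → vgcd (xs ∷ʳ y) ≡ gcd (vgcd xs) ∣ y ∣
    vgcd-∷ʳ [] y = trans (gcd-identityʳ ∣ y ∣) (sym (gcd-identityˡ ∣ y ∣))
    vgcd-∷ʳ (x ∷ xs) y = trans (cong (gcd ∣ x ∣) (vgcd-∷ʳ xs y)) (sym (gcd-assoc (∣ x ∣) (vgcd xs) (∣ y ∣)))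

  rotateʳ : ∀ {d} → Pt (suc d) → Pt (suc d)
  rotateʳ xs = lastV xs ∷ initV xs

  rotateˡ-rotateʳ : ∀ {d} (xs : Pt (suc d)) → rotateˡ (rotateʳ xs) ≡ xs
  rotateˡ-rotateʳ = initV-∷ʳ-lastV

  rotateˡ-injective : ∀ {d} (x y : Pt (suc d)) → rotateˡ x ≡ rotateˡ y → x ≡ y
  rotateˡ-injective (a ∷ xs) (b ∷ ys) e with Vecₚ.∷ʳ-injective xs ys e
  ... | xs≡ys , a≡b = cong₂ _∷_ a≡b xs≡ys

  rotateˡ-neg : ∀ {d} (x : Pt (suc d)) → rotateˡ (neg x) ≡ neg (rotateˡ x)
  rotateˡ-neg (x ∷ xs) = sym (Vecₚ.map-∷ʳ _ x xs)

  lookup-rotateˡ : ∀ {d} (x : Pt (suc d)) (a : Fin d) → lookup (rotateˡ x) (inject₁ a) ≡ lookup x (suc a)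
  lookup-rotateˡ (x ∷ xs) a = lookup-∷ʳ xs x a

  l1-rotateˡ : ∀ {d} (x : Pt (suc d)) → l1 (rotateˡ x) ≡ l1 x
  l1-rotateˡ (x ∷ xs) = trans (l1-∷ʳ xs x) (ℕₚ.+-comm (l1 xs) ∣ x ∣)

  vgcd-rotateˡ : ∀ {d} (x : Pt (suc d)) → vgcd (rotateˡ x) ≡ vgcd x
  vgcd-rotateˡ (x ∷ xs) = trans (vgcd-∷ʳ xs x) (gcd-comm (vgcd xs) ∣ x ∣)

  l1-rotateʳ : ∀ {d} (x : Pt (suc d)) → l1 (rotateʳ x) ≡ l1 x
  l1-rotateʳ x = trans (sym (l1-rotateˡ (rotateʳ x))) (cong l1 (rotateˡ-rotateʳ x))

  vgcd-rotateʳ : ∀ {d} (x : Pt (suc d)) → vgcd (rotateʳ x) ≡ vgcd x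
  vgcd-rotateʳ x = trans (sym (vgcd-rotateˡ (rotateʳ x))) (cong vgcd (rotateˡ-rotateʳ x))

  l1-preserves-≢zeroV : ∀ {d} {x y : Pt d} → l1 x ≡ l1 y → x ≢ zeroV → y ≢ zeroV
  l1-preserves-≢zeroV {d} {x = x} l1x≡l1y x≢0 refl = x≢0 (l1≡0⇒≡zeroV x (trans l1x≡l1y (l1-zeroV d)))
    where
    l1-zeroV : ∀ d → l1 (zeroV {d}) ≡ 0
    l1-zeroV zero = refl
    l1-zeroV (suc d) = l1-zeroV d

  IsH1Gen-orient : ∀ {d} p (z : Pt d) → z ≢ zeroV → vgcd z ≡ 1 → l1 z ℕ.≤ p → IsH1Gen p (orient z)
  IsH1Gen-orient p z z≢0 vgcd-z l1-z with orient-≡-or-neg z | orient-FirstNonzeroPos z z≢0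
  ... | inj₁ e | pz rewrite e = (z≢0 , vgcd-z) , l1-z , pz
  ... | inj₂ e | pz rewrite e = (l1-preserves-≢zeroV (sym (l1-neg z)) z≢0 , trans (vgcd-neg z) vgcd-z) ,
                                subst (ℕ._≤ p) (sym (l1-neg z)) l1-z , pz

  turn : ∀ {d} → Pt (suc d) → Pt (suc d)
  turn x = orient (rotateˡ x)

  ∣lookup-turn∣ : ∀ {d} (x : Pt (suc d)) a → ∣ lookup (turn x) (inject₁ a) ∣ ≡ ∣ lookup x (suc a) ∣
  ∣lookup-turn∣ x a with orient-≡-or-neg (rotateˡ x)
  ... | inj₁ e = trans (cong (λ w → ∣ lookup w (inject₁ a) ∣) e) (cong ∣_∣ (lookup-rotateˡ x a))
  ... | inj₂ e = trans (cong (λ w → ∣ lookup w (inject₁ a) ∣) e)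
                   (trans (cong ∣_∣ (Vecₚ.lookup-map (inject₁ a) _ (rotateˡ x)))
                     (trans (ℤₚ.∣-i∣≡∣i∣ (lookup (rotateˡ x) (inject₁ a))) (cong ∣_∣ (lookup-rotateˡ x a))))

  module _ {d : ℕ} (p : ℕ) where

    IsH1Gen-turn : ∀ (x : Pt (suc d)) → IsH1Gen p x → IsH1Gen p (turn x)
    IsH1Gen-turn x ((x≢0 , vgcd-x) , l1-x , _) = IsH1Gen-orient p (rotateˡ x)
      (l1-preserves-≢zeroV (sym (l1-rotateˡ x)) x≢0) (trans (vgcd-rotateˡ x) vgcd-x) (subst (ℕ._≤ p) (sym (l1-rotateˡ x)) l1-x)

    turn-injective : ∀ (x y : Pt (suc d)) → IsH1Gen p x → IsH1Gen p y → turn x ≡ turn y → x ≡ y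
    turn-injective x y (_ , _ , px) (_ , _ , py) e with orient-≡⇒≡-or-neg (rotateˡ x) (rotateˡ y) e
    ... | inj₁ e′ = rotateˡ-injective x y e′
    ... | inj₂ e′ = ⊥-elim (FirstNonzeroPos-neg-exclusive y py
                      (subst FirstNonzeroPos (rotateˡ-injective x (neg y) (trans e′ (sym (rotateˡ-neg y)))) px))

    turn-surjective : ∀ (y : Pt (suc d)) → IsH1Gen p y → Σ (Pt (suc d)) λ x → IsH1Gen p x × turn x ≡ y
    turn-surjective y ((y≢0 , vgcd-y) , l1-y , py) = orient (rotateʳ y) , H1-x , turn-x≡y
      where
      H1-x : IsH1Gen p (orient (rotateʳ y))
      H1-x = IsH1Gen-orient p (rotateʳ y) (l1-preserves-≢zeroV (sym (l1-rotateʳ y)) y≢0)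
        (trans (vgcd-rotateʳ y) vgcd-y) (subst (ℕ._≤ p) (sym (l1-rotateʳ y)) l1-y)
      turn-x≡y : turn (orient (rotateʳ y)) ≡ y
      turn-x≡y with orient-≡-or-neg (rotateʳ y)
      ... | inj₁ e = trans (cong turn e) (trans (cong orient (rotateˡ-rotateʳ y)) (orient-id y py))
      ... | inj₂ e = trans (cong turn e)
                       (trans (cong orient (trans (rotateˡ-neg (rotateʳ y)) (cong neg (rotateˡ-rotateʳ y)))) (orient-neg y py))

    module _ (gH : List (Pt (suc d))) (gH! : Unique gH) (gH-H1 : ∀ x → (x ∈ gH) ⇔ IsH1Gen p x) where

      private
        to : ∀ {x} → x ∈ gH → IsH1Gen p x
        to {x} = Equivalence.to (gH-H1 x)
        from : ∀ {x} → IsH1Gen p x → x ∈ gH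
        from {x} = Equivalence.from (gH-H1 x)

      map-turn-↭ : List.map turn gH ↭ gH
      map-turn-↭ = unique-⇔⇒↭ (Unique-map⁺ turn gH! (λ x∈ y∈ → turn-injective _ _ (to x∈) (to y∈))) gH! into onto
        where
        into : ∀ {y} → y ∈ List.map turn gH → y ∈ gH
        into y∈ with ∈-map⁻ turn y∈
        ... | x , x∈ , refl = from (IsH1Gen-turn x (to x∈))
        onto : ∀ {y} → y ∈ gH → y ∈ List.map turn gH
        onto {y} y∈ with turn-surjective y (to y∈)
        ... | x , H1-x , refl = ∈-map⁺ turn (from H1-x)

      columnSum-shift : ∀ (a : Fin d) → columnSum (inject₁ a) gH ≡ columnSum (suc a) gH
      columnSum-shift a = begin
        columnSum (inject₁ a) gH                                           ≡⟨ sum-↭ (map⁺ _ map-turn-↭) ⟨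
        sum (List.map (λ x → ∣ lookup x (inject₁ a) ∣) (List.map turn gH)) ≡⟨ cong sum (Listₚ.map-∘ gH) ⟨
        sum (List.map (λ x → ∣ lookup (turn x) (inject₁ a) ∣) gH)         ≡⟨ cong sum (Listₚ.map-cong (λ x → ∣lookup-turn∣ x a) gH) ⟩
        columnSum (suc a) gH                                               ∎
        where open ≡-Reasoning

      columnSum-constant : ∀ (i : Fin (suc d)) → columnSum i gH ≡ columnSum zero gH
      columnSum-constant i = by-position (toℕ i) i refl
        where
        by-position : ∀ m (i : Fin (suc d)) → toℕ i ≡ m → columnSum i gH ≡ columnSum zero gH
        by-position zero zero _ = refl
        by-position (suc m) (suc a) i≡m =
          trans (sym (columnSum-shift a)) (by-position m (inject₁ a) (trans (Finₚ.toℕ-inject₁ a) (ℕₚ.suc-injective i≡m)))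

module Width where

  open import Defs
  open Vectors
  open SubsetSums using (∑ℕ; ∑ℕ-distrib-+; ∑ℕ-const; ∑ℕ-bound)
  open GeneratorExchange using (l1Sum)
  open Symmetry using (columnSum; columnSum-constant)
  open import Data.Nat as ℕ using (ℕ; zero; suc; z≤n)
  import Data.Nat.Properties as ℕₚ
  open import Data.Integer using (ℤ; +_; -[1+_]; 0ℤ; -_; _+_; _-_; _≤_; ∣_∣; +≤+; -≤+)
  import Data.Integer.Properties as ℤₚ
  open import Data.Integer.Tactic.RingSolver using (solve-∀)
  open import Data.Vec using ([]; _∷_; lookup; tabulate)
  import Data.Vec.Properties as Vecₚ
  import Data.Vec.Relation.Unary.All as VAll
  import Data.Vec.Relation.Unary.All.Properties as VAllₚ
  open import Data.Fin using (Fin; zero; suc)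
  open import Data.List using (List; []; _∷_)
  open import Data.List.Membership.Propositional using (_∈_)
  open import Data.List.Membership.Propositional.Properties using (∈-map⁺; ∈-map⁻; ∈-++⁺ˡ; ∈-++⁺ʳ; ∈-++⁻)
  open import Data.List.Relation.Unary.Any using (here)
  open import Data.List.Relation.Unary.Unique.Propositional using (Unique)
  open import Data.Product using (∃₂; _×_; _,_; proj₁; proj₂)
  open import Data.Sum using (inj₁; inj₂)
  open import Function.Bundles using (_⇔_)
  open import Function using (_∘_)
  open import Relation.Binary.PropositionalEquality

  lookup-⊕ : ∀ {d} (x y : Pt d) i → lookup (x ⊕ y) i ≡ lookup x i + lookup y i
  lookup-⊕ x y i = Vecₚ.lookup-zipWith _+_ i x y

  ∑-columnSum : ∀ {d} (gs : List (Pt d)) → ∑ℕ (λ i → columnSum i gs) ≡ l1Sum gs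
  ∑-columnSum {d} [] = trans (∑ℕ-const {d} (λ _ → 0) 0 (λ _ → refl)) (ℕₚ.*-zeroʳ d)
  ∑-columnSum (g ∷ gs) = trans (∑ℕ-distrib-+ (λ i → ∣ lookup g i ∣) (λ i → columnSum i gs))
    (cong₂ ℕ._+_ (sym (l1-∑ g)) (∑-columnSum gs))
    where
    l1-∑ : ∀ {d} (x : Pt d) → l1 x ≡ ∑ℕ (λ i → ∣ lookup x i ∣)
    l1-∑ [] = refl
    l1-∑ (a ∷ x) = cong (∣ a ∣ ℕ.+_) (l1-∑ x)

  -- Put g into the larger sum exactly when its i-th coordinate is nonnegative.
  extreme-subsetSums : ∀ {d} (gs : List (Pt d)) i → ∃₂ λ u v → u ∈ subsetSums gs × v ∈ subsetSums gs ×
    lookup v i ≡ lookup u i + + columnSum i gs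
  extreme-subsetSums [] i = zeroV , zeroV , here refl , here refl , sym (ℤₚ.+-identityʳ _)
  extreme-subsetSums (g ∷ gs) i with extreme-subsetSums gs i | ℤₚ.≤-total 0ℤ (lookup g i)
  ... | u , v , u∈ , v∈ , v≡u+c | inj₁ gᵢ≥0 =
    u , g ⊕ v , ∈-++⁺ˡ u∈ , ∈-++⁺ʳ (subsetSums gs) (∈-map⁺ (g ⊕_) v∈) , (begin
      lookup (g ⊕ v) i                          ≡⟨ lookup-⊕ g v i ⟩
      lookup g i + lookup v i                   ≡⟨ cong₂ _+_ (sym (ℤₚ.0≤i⇒+∣i∣≡i gᵢ≥0)) v≡u+c ⟩
      + ∣ lookup g i ∣ + (lookup u i + + c)     ≡⟨ regroup (+ ∣ lookup g i ∣) (lookup u i) (+ c) ⟩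
      lookup u i + (+ ∣ lookup g i ∣ + + c)     ≡⟨ cong (λ x → lookup u i + x) (sym (ℤₚ.pos-+ ∣ lookup g i ∣ c)) ⟩
      lookup u i + + (∣ lookup g i ∣ ℕ.+ c)     ∎)
    where
    open ≡-Reasoning
    c = columnSum i gs
    regroup : ∀ (a b e : ℤ) → a + (b + e) ≡ b + (a + e)
    regroup = solve-∀
  ... | u , v , u∈ , v∈ , v≡u+c | inj₂ gᵢ≤0 =
    g ⊕ u , v , ∈-++⁺ʳ (subsetSums gs) (∈-map⁺ (g ⊕_) u∈) , ∈-++⁺ˡ v∈ , (begin
      lookup v i                                       ≡⟨ v≡u+c ⟩
      lookup u i + + c                                 ≡⟨ regroup (lookup g i) (lookup u i) (+ c) ⟩
      (lookup g i + lookup u i) + (- lookup g i + + c) ≡⟨ cong₂ (λ a b → a + (b + + c)) (lookup-⊕ g u i) ∣gᵢ∣≡-gᵢ ⟨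
      lookup (g ⊕ u) i + (+ ∣ lookup g i ∣ + + c)      ≡⟨ cong (λ x → lookup (g ⊕ u) i + x) (sym (ℤₚ.pos-+ ∣ lookup g i ∣ c)) ⟩
      lookup (g ⊕ u) i + + (∣ lookup g i ∣ ℕ.+ c)      ∎)
    where
    open ≡-Reasoning
    c = columnSum i gs
    regroup : ∀ (a b e : ℤ) → b + e ≡ (a + b) + (- a + e)
    regroup = solve-∀
    ∣gᵢ∣≡-gᵢ : + ∣ lookup g i ∣ ≡ - lookup g i
    ∣gᵢ∣≡-gᵢ = trans (cong +_ (sym (ℤₚ.∣-i∣≡∣i∣ (lookup g i)))) (ℤₚ.0≤i⇒+∣i∣≡i (ℤₚ.neg-mono-≤ gᵢ≤0))

  private
    lookup-translate : ∀ {d} (t w t′ : Pt d) i → lookup ((t ⊕ w) ⊕ t′) i ≡ lookup t i + lookup w i + lookup t′ i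
    lookup-translate t w t′ i = trans (lookup-⊕ (t ⊕ w) t′ i) (cong (_+ lookup t′ i) (lookup-⊕ t w i))

  columnSum≤width : ∀ {d} (t : Pt d) (gs : List (Pt d)) k → FitsIn (zonoPoints t gs) k → ∀ i → columnSum i gs ℕ.≤ k
  columnSum≤width t gs k (t′ , inBox) i with extreme-subsetSums gs i
  ... | u , v , u∈ , v∈ , v≡u+c = ℤₚ.drop‿+≤+ (begin
    + c                                        ≡⟨ ℤₚ.+-identityˡ (+ c) ⟨
    0ℤ + + c                                   ≤⟨ ℤₚ.+-monoˡ-≤ (+ c) (proj₁ (box u u∈)) ⟩
    lookup ((t ⊕ u) ⊕ t′) i + + c              ≡⟨ shift ⟩
    lookup ((t ⊕ v) ⊕ t′) i                    ≤⟨ proj₂ (box v v∈) ⟩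
    + k                                        ∎)
    where
    open ℤₚ.≤-Reasoning
    c = columnSum i gs
    box : ∀ w → w ∈ subsetSums gs → (0ℤ ≤ lookup ((t ⊕ w) ⊕ t′) i) × (lookup ((t ⊕ w) ⊕ t′) i ≤ + k)
    box w w∈ = VAllₚ.lookup⁺ (inBox (t ⊕ w) (∈-map⁺ (t ⊕_) w∈)) i
    regroup : ∀ (a b e f : ℤ) → a + b + f + e ≡ a + (b + e) + f
    regroup = solve-∀
    shift : lookup ((t ⊕ u) ⊕ t′) i + + c ≡ lookup ((t ⊕ v) ⊕ t′) i
    shift = trans (cong (_+ + c) (lookup-translate t u t′ i))
      (trans (regroup (lookup t i) (lookup u i) (+ c) (lookup t′ i))
        (sym (trans (lookup-translate t v t′ i) (cong (λ x → lookup t i + x + lookup t′ i) v≡u+c))))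

  private
    negativePart : ℤ → ℤ
    negativePart (+ _) = 0ℤ
    negativePart -[1+ m ] = -[1+ m ]

    negativePart≤0 : ∀ z → negativePart z ≤ 0ℤ
    negativePart≤0 (+ n) = ℤₚ.≤-refl
    negativePart≤0 -[1+ m ] = -≤+

    negativePart≤id : ∀ z → negativePart z ≤ z
    negativePart≤id (+ n) = +≤+ z≤n
    negativePart≤id -[1+ m ] = ℤₚ.≤-refl

    id≤negativePart+∣∣ : ∀ z → z ≤ negativePart z + + ∣ z ∣
    id≤negativePart+∣∣ (+ n) = ℤₚ.≤-reflexive (sym (ℤₚ.+-identityˡ (+ n)))
    id≤negativePart+∣∣ -[1+ m ] = ℤₚ.i≤i+j -[1+ m ] (+ suc m)

    0≤negativePart+∣∣ : ∀ z → 0ℤ ≤ negativePart z + + ∣ z ∣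
    0≤negativePart+∣∣ (+ n) = ℤₚ.≤-trans (+≤+ z≤n) (ℤₚ.≤-reflexive (sym (ℤₚ.+-identityˡ (+ n))))
    0≤negativePart+∣∣ -[1+ m ] = ℤₚ.≤-reflexive (sym (ℤₚ.+-inverseˡ (+ suc m)))

    columnFloor : ∀ {d} → Fin d → List (Pt d) → ℤ
    columnFloor i [] = 0ℤ
    columnFloor i (g ∷ gs) = negativePart (lookup g i) + columnFloor i gs

    regroup : ∀ (a b e f : ℤ) → a + b + (e + f) ≡ a + e + (b + f)
    regroup = solve-∀

    subsetSum-range : ∀ {d} (gs : List (Pt d)) i {w} → w ∈ subsetSums gs →
      columnFloor i gs ≤ lookup w i × lookup w i ≤ columnFloor i gs + + columnSum i gs
    subsetSum-range [] i (here refl) = ℤₚ.≤-reflexive (sym zeroᵢ) , ℤₚ.≤-reflexive zeroᵢ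
      where zeroᵢ = Vecₚ.lookup-replicate i 0ℤ
    subsetSum-range (g ∷ gs) i {w} w∈ with ∈-++⁻ (subsetSums gs) w∈
    ... | inj₁ w∈′ = lower , upper
      where
      open ℤₚ.≤-Reasoning
      F = columnFloor i gs
      c = columnSum i gs
      gᵢ = lookup g i
      range = subsetSum-range gs i w∈′
      lower : negativePart gᵢ + F ≤ lookup w i
      lower = begin
        negativePart gᵢ + F  ≤⟨ ℤₚ.+-monoˡ-≤ F (negativePart≤0 gᵢ) ⟩
        0ℤ + F               ≡⟨ ℤₚ.+-identityˡ F ⟩
        F                    ≤⟨ proj₁ range ⟩
        lookup w i           ∎
      upper : lookup w i ≤ negativePart gᵢ + F + + (∣ gᵢ ∣ ℕ.+ c)
      upper = begin
        lookup w i                                   ≤⟨ proj₂ range ⟩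
        F + + c                                      ≡⟨ ℤₚ.+-identityˡ (F + + c) ⟨
        0ℤ + (F + + c)                               ≤⟨ ℤₚ.+-monoˡ-≤ (F + + c) (0≤negativePart+∣∣ gᵢ) ⟩
        negativePart gᵢ + + ∣ gᵢ ∣ + (F + + c)       ≡⟨ regroup (negativePart gᵢ) (+ ∣ gᵢ ∣) F (+ c) ⟩
        negativePart gᵢ + F + (+ ∣ gᵢ ∣ + + c)       ≡⟨ cong (λ x → negativePart gᵢ + F + x) (ℤₚ.pos-+ ∣ gᵢ ∣ c) ⟨
        negativePart gᵢ + F + + (∣ gᵢ ∣ ℕ.+ c)       ∎
    ... | inj₂ w∈′ with ∈-map⁻ (g ⊕_) w∈′
    ...   | w₀ , w₀∈ , refl = lower , upper
      where
      open ℤₚ.≤-Reasoning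
      F = columnFloor i gs
      c = columnSum i gs
      gᵢ = lookup g i
      range = subsetSum-range gs i w₀∈
      lower : negativePart gᵢ + F ≤ lookup (g ⊕ w₀) i
      lower = begin
        negativePart gᵢ + F      ≤⟨ ℤₚ.+-mono-≤ (negativePart≤id gᵢ) (proj₁ range) ⟩
        gᵢ + lookup w₀ i         ≡⟨ lookup-⊕ g w₀ i ⟨
        lookup (g ⊕ w₀) i        ∎
      upper : lookup (g ⊕ w₀) i ≤ negativePart gᵢ + F + + (∣ gᵢ ∣ ℕ.+ c)
      upper = begin
        lookup (g ⊕ w₀) i                            ≡⟨ lookup-⊕ g w₀ i ⟩
        gᵢ + lookup w₀ i                             ≤⟨ ℤₚ.+-mono-≤ (id≤negativePart+∣∣ gᵢ) (proj₂ range) ⟩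
        negativePart gᵢ + + ∣ gᵢ ∣ + (F + + c)       ≡⟨ regroup (negativePart gᵢ) (+ ∣ gᵢ ∣) F (+ c) ⟩
        negativePart gᵢ + F + (+ ∣ gᵢ ∣ + + c)       ≡⟨ cong (λ x → negativePart gᵢ + F + x) (ℤₚ.pos-+ ∣ gᵢ ∣ c) ⟨
        negativePart gᵢ + F + + (∣ gᵢ ∣ ℕ.+ c)       ∎

  -- Translate by minus the coordinatewise sum of the negative parts of the generators.
  fits-in-columnSum : ∀ {d} (gs : List (Pt d)) W → (∀ i → columnSum i gs ℕ.≤ W) → FitsIn (zonoPoints zeroV gs) W
  fits-in-columnSum gs W bounded = t′ , inBox
    where
    t′ = tabulate (λ i → - columnFloor i gs)
    inBox : ∀ w → w ∈ zonoPoints zeroV gs → InBox W (w ⊕ t′)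
    inBox w w∈ with ∈-map⁻ (zeroV ⊕_) w∈
    ... | w₀ , w₀∈ , refl = VAllₚ.lookup⁻ λ i → lower i , upper i
      where
      open ℤₚ.≤-Reasoning
      coordinate : ∀ i → lookup ((zeroV ⊕ w₀) ⊕ t′) i ≡ lookup w₀ i - columnFloor i gs
      coordinate i = trans (lookup-⊕ (zeroV ⊕ w₀) t′ i)
        (cong₂ _+_ (cong (λ x → lookup x i) (⊕-identityˡ w₀)) (Vecₚ.lookup∘tabulate _ i))
      lower : ∀ i → 0ℤ ≤ lookup ((zeroV ⊕ w₀) ⊕ t′) i
      lower i = subst (0ℤ ≤_) (sym (coordinate i)) (ℤₚ.i≤j⇒0≤j-i (proj₁ (subsetSum-range gs i w₀∈)))
      upper : ∀ i → lookup ((zeroV ⊕ w₀) ⊕ t′) i ≤ + W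
      upper i = begin
        lookup ((zeroV ⊕ w₀) ⊕ t′) i   ≡⟨ coordinate i ⟩
        lookup w₀ i - F                ≤⟨ ℤₚ.+-monoˡ-≤ (- F) (proj₂ (subsetSum-range gs i w₀∈)) ⟩
        F + + columnSum i gs - F       ≡⟨ cancel F (+ columnSum i gs) ⟩
        + columnSum i gs               ≤⟨ +≤+ (bounded i) ⟩
        + W                            ∎
        where
        F = columnFloor i gs
        cancel : ∀ (a e : ℤ) → a + e - a ≡ e
        cancel = solve-∀

  l1Sum≤d*k : ∀ {d} (t : Pt d) (gs : List (Pt d)) k → FitsIn (zonoPoints t gs) k → l1Sum gs ℕ.≤ d ℕ.* k
  l1Sum≤d*k t gs k fits = subst (ℕ._≤ _) (∑-columnSum gs) (∑ℕ-bound _ k (columnSum≤width t gs k fits))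

  -- All column sums of H₁ are equal, hence equal to l1Sum gH / d, and H₁ fits in a box of that size.
  d*k≤l1Sum-H1 : ∀ {d} p (gH : List (Pt d)) → Unique gH → (∀ x → (x ∈ gH) ⇔ IsH1Gen p x) →
    ∀ k → KVal (zonoPoints zeroV gH) k → d ℕ.* k ℕ.≤ l1Sum gH
  d*k≤l1Sum-H1 {zero} p gH gH! gH-H1 k _ = z≤n
  d*k≤l1Sum-H1 {suc d} p gH gH! gH-H1 k (_ , minimal) = begin
    suc d ℕ.* k                ≤⟨ ℕₚ.*-monoʳ-≤ (suc d) (minimal W (fits-in-columnSum gH W (ℕₚ.≤-reflexive ∘ constant))) ⟩
    suc d ℕ.* W                ≡⟨ ∑ℕ-const _ W constant ⟨
    ∑ℕ (λ i → columnSum i gH)  ≡⟨ ∑-columnSum gH ⟩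
    l1Sum gH                   ∎
    where
    open ℕₚ.≤-Reasoning
    W = columnSum zero gH
    constant = columnSum-constant p gH gH! gH-H1

  d*k≤d*k′⇒k≤k′ : ∀ {d} {S : List (Pt d)} {k k′} → KVal S k → d ℕ.* k ℕ.≤ d ℕ.* k′ → k ℕ.≤ k′
  d*k≤d*k′⇒k≤k′ {zero} (_ , minimal) _ = ℕₚ.≤-trans (minimal 0 ([] , λ { [] _ → VAll.[] })) z≤n
  d*k≤d*k′⇒k≤k′ {suc d} _ dk≤dk′ = ℕₚ.*-cancelˡ-≤ (suc d) dk≤dk′

module LexFunctional where

  open import Defs
  open Integers using (K*x+e>0)
  open import Data.Nat as ℕ using (ℕ; zero; suc; _^_; z≤n; s≤s)
  import Data.Nat.Properties as ℕₚ
  open import Data.Nat.Tactic.RingSolver using (solve-∀)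
  open import Data.Integer using (+_; 0ℤ; _+_; _*_; _<_; ∣_∣)
  import Data.Integer.Properties as ℤₚ
  open import Data.Vec using ([]; _∷_)
  open import Data.Product using (_,_)
  open import Data.Sum using (inj₁; inj₂)
  open import Relation.Binary.PropositionalEquality

  -- With M = p + 1, its sign on a vector of ℓ¹-norm ≤ p is that of the first nonzero coordinate.
  lexFunctional : ℕ → ∀ d → Pt d
  lexFunctional M zero = []
  lexFunctional M (suc d) = + (M ^ d) ∷ lexFunctional M d

  ∣lex·x∣*M≤l1*M^d : ∀ p d (x : Pt d) → ∣ dot (lexFunctional (suc p) d) x ∣ ℕ.* suc p ℕ.≤ l1 x ℕ.* suc p ^ d
  ∣lex·x∣*M≤l1*M^d p zero [] = z≤n
  ∣lex·x∣*M≤l1*M^d p (suc d) (a ∷ x) = begin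
      ∣ + (M ^ d) * a + D ∣ ℕ.* M
    ≤⟨ ℕₚ.*-monoˡ-≤ M (ℤₚ.∣i+j∣≤∣i∣+∣j∣ (+ (M ^ d) * a) D) ⟩
      (∣ + (M ^ d) * a ∣ ℕ.+ ∣ D ∣) ℕ.* M
    ≡⟨ cong (λ z → (z ℕ.+ ∣ D ∣) ℕ.* M) (ℤₚ.abs-* (+ (M ^ d)) a) ⟩
      (M ^ d ℕ.* ∣ a ∣ ℕ.+ ∣ D ∣) ℕ.* M
    ≡⟨ ℕₚ.*-distribʳ-+ M (M ^ d ℕ.* ∣ a ∣) ∣ D ∣ ⟩
      M ^ d ℕ.* ∣ a ∣ ℕ.* M ℕ.+ ∣ D ∣ ℕ.* M
    ≤⟨ ℕₚ.+-mono-≤ (ℕₚ.≤-reflexive (regroup (M ^ d) ∣ a ∣ M))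
                    (ℕₚ.≤-trans (∣lex·x∣*M≤l1*M^d p d x) (ℕₚ.*-monoʳ-≤ (l1 x) (ℕₚ.m≤n*m (M ^ d) M))) ⟩
      ∣ a ∣ ℕ.* M ^ suc d ℕ.+ l1 x ℕ.* M ^ suc d
    ≡⟨ ℕₚ.*-distribʳ-+ (M ^ suc d) ∣ a ∣ (l1 x) ⟨
      (∣ a ∣ ℕ.+ l1 x) ℕ.* M ^ suc d ∎
    where
    open ℕₚ.≤-Reasoning
    M = suc p
    D = dot (lexFunctional (suc p) d) x
    regroup : ∀ P A M → P ℕ.* A ℕ.* M ≡ A ℕ.* (M ℕ.* P)
    regroup = solve-∀

  lexFunctional-pos : ∀ p d (x : Pt d) → FirstNonzeroPos x → l1 x ℕ.≤ p → 0ℤ < dot (lexFunctional (suc p) d) x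
  lexFunctional-pos p (suc d) (a ∷ x) (inj₁ a>0) l1≤p = K*x+e>0 (suc p ^ d) a D a>0 ∣D∣<M^d
    where
    D = dot (lexFunctional (suc p) d) x
    M^d>0 : 0 ℕ.< suc p ^ d
    M^d>0 = ℕₚ.m^n>0 (suc p) d
    ∣D∣*M<M^d*M : ∣ D ∣ ℕ.* suc p ℕ.< suc p ^ d ℕ.* suc p
    ∣D∣*M<M^d*M = ℕₚ.≤-<-trans (∣lex·x∣*M≤l1*M^d p d x)
      (ℕₚ.<-≤-trans (ℕₚ.*-monoˡ-< (suc p ^ d) {{ℕ.>-nonZero M^d>0}} (s≤s (ℕₚ.≤-trans (ℕₚ.m≤n+m (l1 x) ∣ a ∣) l1≤p)))
        (ℕₚ.≤-reflexive (ℕₚ.*-comm (suc p) (suc p ^ d))))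
    ∣D∣<M^d : ∣ D ∣ ℕ.< suc p ^ d
    ∣D∣<M^d = ℕₚ.*-cancelʳ-< (suc p) ∣ D ∣ (suc p ^ d) ∣D∣*M<M^d*M
  lexFunctional-pos p (suc d) (a ∷ x) (inj₂ (refl , px)) l1≤p =
    subst (0ℤ <_) (sym (trans (cong (_+ dot (lexFunctional (suc p) d) x) (ℤₚ.*-zeroʳ (+ (suc p ^ d)))) (ℤₚ.+-identityˡ _)))
      (lexFunctional-pos p d x px l1≤p)

module Translates where

  open import Defs
  open Vectors
  open Integers using (+-cancelˡ-≤)
  open PrimitivePart using (prim; prim-≡⇒collinear; l1-prim≡l1⇒≡±prim)
  open GeneratorExchange using (Matching)
  open ListFacts using (unique-⇔⇒↭; Unique-map⁺; AllPairs-∈)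
  open import Data.Nat using (ℕ)
  open import Data.Integer using (+_; _+_; _≤_)
  import Data.Integer.Properties as ℤₚ
  open import Data.List as List using (List; []; _∷_)
  open import Data.List.Membership.Propositional using (_∈_)
  open import Data.List.Membership.Propositional.Properties using (∈-map⁺; ∈-map⁻; ∈-++⁺ˡ; ∈-++⁺ʳ; ∈-++⁻)
  open import Data.List.Relation.Unary.Any using (here)
  open import Data.List.Relation.Unary.All as All using (All; []; _∷_)
  import Data.List.Relation.Unary.AllPairs as AllPairs
  open import Data.List.Relation.Unary.Unique.Propositional using (Unique)
  open import Data.List.Relation.Binary.Permutation.Propositional using (_↭_; refl; prep; swap; trans; ↭-sym)
  open import Data.Product using (∃; _×_; _,_; proj₁; proj₂)
  open import Data.Sum using (_⊎_; inj₁; inj₂)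
  open import Data.Empty using (⊥-elim)
  open import Relation.Nullary using (yes; no)
  open import Function using (_∘_)
  open import Relation.Binary.PropositionalEquality as ≡ using (_≡_; cong; sym; subst; subst₂)

  record Shifted {d} (S T : List (Pt d)) (u : Pt d) : Set where
    field
      shift⁺ : ∀ {x} → x ∈ T → x ⊕ u ∈ S
      shift⁻ : ∀ {y} → y ∈ S → ∃ λ x → x ∈ T × y ≡ x ⊕ u

  open Shifted

  module _ {d : ℕ} where

    Shifted-trans : ∀ {S T R : List (Pt d)} {u v} → Shifted S T u → Shifted T R v → Shifted S R (v ⊕ u)
    shift⁺ (Shifted-trans {u = u} {v} S=T+u T=R+v) {x} x∈R =
      subst (_∈ _) (⊕-assoc x v u) (shift⁺ S=T+u (shift⁺ T=R+v x∈R))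
    shift⁻ (Shifted-trans {u = u} {v} S=T+u T=R+v) y∈S with shift⁻ S=T+u y∈S
    ... | x , x∈T , ≡.refl with shift⁻ T=R+v x∈T
    ...   | r , r∈R , ≡.refl = r , r∈R , ⊕-assoc r v u

    Shifted-by-zeroV : ∀ {S T : List (Pt d)} → (∀ {x} → x ∈ T → x ∈ S) → (∀ {y} → y ∈ S → y ∈ T) → Shifted S T zeroV
    shift⁺ (Shifted-by-zeroV T⊆S _) {x} x∈T = subst (_∈ _) (sym (⊕-identityʳ x)) (T⊆S x∈T)
    shift⁻ (Shifted-by-zeroV _ S⊆T) {y} y∈S = y , S⊆T y∈S , sym (⊕-identityʳ y)

    map-Shifted : ∀ (t : Pt d) S → Shifted (List.map (t ⊕_) S) S t
    shift⁺ (map-Shifted t S) {x} x∈S = subst (_∈ _) (⊕-comm t x) (∈-map⁺ (t ⊕_) x∈S)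
    shift⁻ (map-Shifted t S) y∈ with ∈-map⁻ (t ⊕_) y∈
    ... | x , x∈S , ≡.refl = x , x∈S , ⊕-comm t x

    private
      SS = subsetSums {d}

      ∈SS-∷ : ∀ g gs {w} → w ∈ SS (g ∷ gs) → w ∈ SS gs ⊎ ∃ λ w₀ → w₀ ∈ SS gs × w ≡ g ⊕ w₀
      ∈SS-∷ g gs w∈ with ∈-++⁻ (SS gs) w∈
      ... | inj₁ w∈′ = inj₁ w∈′
      ... | inj₂ w∈′ with ∈-map⁻ (g ⊕_) w∈′
      ...   | w₀ , w₀∈ , ≡.refl = inj₂ (w₀ , w₀∈ , ≡.refl)

      without : ∀ g gs {w} → w ∈ SS gs → w ∈ SS (g ∷ gs)
      without g gs = ∈-++⁺ˡ

      with′ : ∀ g gs {w} → w ∈ SS gs → g ⊕ w ∈ SS (g ∷ gs)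
      with′ g gs = ∈-++⁺ʳ (SS gs) ∘ ∈-map⁺ (g ⊕_)

    subsetSums-↭ : ∀ {xs ys : List (Pt d)} → xs ↭ ys → ∀ {w} → w ∈ SS xs → w ∈ SS ys
    subsetSums-↭ refl w∈ = w∈
    subsetSums-↭ (prep {xs} {ys} x xs↭ys) w∈ with ∈SS-∷ x xs w∈
    ... | inj₁ w∈′ = without x ys (subsetSums-↭ xs↭ys w∈′)
    ... | inj₂ (w₀ , w₀∈ , ≡.refl) = with′ x ys (subsetSums-↭ xs↭ys w₀∈)
    subsetSums-↭ (swap {xs} {ys} x y xs↭ys) w∈ with ∈SS-∷ x (y ∷ xs) w∈
    ... | inj₁ w∈′ with ∈SS-∷ y xs w∈′
    ...   | inj₁ w∈″ = without y (x ∷ ys) (without x ys (subsetSums-↭ xs↭ys w∈″))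
    ...   | inj₂ (w₀ , w₀∈ , ≡.refl) = with′ y (x ∷ ys) (without x ys (subsetSums-↭ xs↭ys w₀∈))
    subsetSums-↭ (swap {xs} {ys} x y xs↭ys) w∈ | inj₂ (w₁ , w₁∈ , ≡.refl) with ∈SS-∷ y xs w₁∈
    ...   | inj₁ w∈″ = without y (x ∷ ys) (with′ x ys (subsetSums-↭ xs↭ys w∈″))
    ...   | inj₂ (w₀ , w₀∈ , ≡.refl) = subst (_∈ SS (y ∷ x ∷ ys)) x⊕y⊕w₀ (with′ y (x ∷ ys) (with′ x ys (subsetSums-↭ xs↭ys w₀∈)))
      where
      x⊕y⊕w₀ : y ⊕ (x ⊕ w₀) ≡ x ⊕ (y ⊕ w₀)
      x⊕y⊕w₀ = ≡.trans (sym (⊕-assoc y x w₀)) (≡.trans (cong (_⊕ w₀) (⊕-comm y x)) (⊕-assoc x y w₀))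
    subsetSums-↭ (trans xs↭ys ys↭zs) w∈ = subsetSums-↭ ys↭zs (subsetSums-↭ xs↭ys w∈)

    subsetSums-∷ : ∀ g {gs hs : List (Pt d)} {u} → Shifted (SS gs) (SS hs) u → Shifted (SS (g ∷ gs)) (SS (g ∷ hs)) u
    shift⁺ (subsetSums-∷ g {gs} {hs} {u} G=H+u) x∈ with ∈SS-∷ g hs x∈
    ... | inj₁ x∈′ = without g gs (shift⁺ G=H+u x∈′)
    ... | inj₂ (x₀ , x₀∈ , ≡.refl) = subst (_∈ _) (sym (⊕-assoc g x₀ u)) (with′ g gs (shift⁺ G=H+u x₀∈))
    shift⁻ (subsetSums-∷ g {gs} {hs} {u} G=H+u) y∈ with ∈SS-∷ g gs y∈
    ... | inj₁ y∈′ with shift⁻ G=H+u y∈′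
    ...   | x , x∈ , y≡x+u = x , without g hs x∈ , y≡x+u
    shift⁻ (subsetSums-∷ g {gs} {hs} {u} G=H+u) y∈ | inj₂ (y₀ , y₀∈ , ≡.refl) with shift⁻ G=H+u y₀∈
    ...   | x , x∈ , ≡.refl = g ⊕ x , with′ g hs x∈ , sym (⊕-assoc g x u)

    subsetSums-neg : ∀ g (gs : List (Pt d)) → Shifted (SS (neg g ∷ gs)) (SS (g ∷ gs)) (neg g)
    shift⁺ (subsetSums-neg g gs) x∈ with ∈SS-∷ g gs x∈
    ... | inj₁ x∈′ = subst (_∈ _) (⊕-comm (neg g) _) (with′ (neg g) gs x∈′)
    ... | inj₂ (x₀ , x₀∈ , ≡.refl) = subst (_∈ _) (sym ([u⊕x]⊕neg[u]≡x g x₀)) (without (neg g) gs x₀∈)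
    shift⁻ (subsetSums-neg g gs) y∈ with ∈SS-∷ (neg g) gs y∈
    ... | inj₁ y∈′ = g ⊕ _ , with′ g gs y∈′ , sym ([u⊕x]⊕neg[u]≡x g _)
    ... | inj₂ (y₀ , y₀∈ , ≡.refl) = y₀ , without g gs y₀∈ , ⊕-comm (neg g) y₀

    subsetSums-prim : ∀ (gs : List (Pt d)) → All (λ g → g ≡ prim g ⊎ g ≡ neg (prim g)) gs →
      ∃ λ u → Shifted (SS gs) (SS (List.map prim gs)) u
    subsetSums-prim [] [] = zeroV , Shifted-by-zeroV (λ x∈ → x∈) (λ y∈ → y∈)
    subsetSums-prim (g ∷ gs) (g≡±pg ∷ signs) with subsetSums-prim gs signs
    ... | u , G=P+u with g≡±pg
    ...   | inj₁ g≡pg = u , subst (λ g′ → Shifted (SS (g′ ∷ gs)) (SS (prim g ∷ List.map prim gs)) u) (sym g≡pg)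
                            (subsetSums-∷ (prim g) {gs} {List.map prim gs} G=P+u)
    ...   | inj₂ g≡-pg = u ⊕ neg (prim g) ,
            subst (λ g′ → Shifted (SS (g′ ∷ gs)) (SS (prim g ∷ List.map prim gs)) (u ⊕ neg (prim g))) (sym g≡-pg)
              (Shifted-trans (subsetSums-neg (prim g) gs) (subsetSums-∷ (prim g) {gs} {List.map prim gs} G=P+u))

    module _ {S T : List (Pt d)} {u} (S=T+u : Shifted S T u) where

      private
        dot-shift : ∀ c x → dot c (x ⊕ u) ≡ dot c u + dot c x
        dot-shift c x = ≡.trans (dot-distribʳ-⊕ c x u) (ℤₚ.+-comm (dot c x) (dot c u))

        Maximizer-shift⁺ : ∀ c x → Maximizer c T x → Maximizer c S (x ⊕ u)
        Maximizer-shift⁺ c x (x∈T , x-max) = shift⁺ S=T+u x∈T , dominated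
          where
          dominated : ∀ y → y ∈ S → dot c y ≤ dot c (x ⊕ u)
          dominated y y∈S with shift⁻ S=T+u y∈S
          ... | z , z∈T , ≡.refl = subst₂ _≤_ (sym (dot-shift c z)) (sym (dot-shift c x)) (ℤₚ.+-monoʳ-≤ (dot c u) (x-max z z∈T))

        Maximizer-shift⁻ : ∀ c x → x ∈ T → Maximizer c S (x ⊕ u) → Maximizer c T x
        Maximizer-shift⁻ c x x∈T (_ , x⊕u-max) = x∈T , λ z z∈T →
          +-cancelˡ-≤ (dot c u) (subst₂ _≤_ (dot-shift c z) (dot-shift c x) (x⊕u-max (z ⊕ u) (shift⁺ S=T+u z∈T)))

      Shifted⇒IsTranslateOf : IsTranslateOf S T
      Shifted⇒IsTranslateOf = u , vertex⁺ , vertex⁻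
        where
        vertex⁺ : ∀ v → IsVertex T v → IsVertex S (v ⊕ u)
        vertex⁺ v (c , v-max , v-unique) = c , Maximizer-shift⁺ c v v-max , unique
          where
          unique : ∀ w → Maximizer c S w → w ≡ v ⊕ u
          unique w w-max with shift⁻ S=T+u (proj₁ w-max)
          ... | x , x∈T , ≡.refl = cong (_⊕ u) (v-unique x (Maximizer-shift⁻ c x x∈T w-max))
        vertex⁻ : ∀ y → IsVertex S y → ∃ λ x → IsVertex T x × y ≡ x ⊕ u
        vertex⁻ y (c , y-max , y-unique) with shift⁻ S=T+u (proj₁ y-max)
        ... | x , x∈T , ≡.refl = x , (c , Maximizer-shift⁻ c x x∈T y-max , unique) , ≡.refl
          where
          unique : ∀ x′ → Maximizer c T x′ → x′ ≡ x
          unique x′ x′-max = ⊕-cancelʳ x′ x u (y-unique (x′ ⊕ u) (Maximizer-shift⁺ c x′ x′-max))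

  zonotope-translate : ∀ {d} (t : Pt d) (gZ gH : List (Pt d)) → All (λ g → g ≡ prim g ⊎ g ≡ neg (prim g)) gZ →
    List.map prim gZ ↭ gH → IsTranslateOf (zonoPoints t gZ) (zonoPoints zeroV gH)
  zonotope-translate t gZ gH signs prim-gZ↭gH with subsetSums-prim gZ signs
  ... | s , GZ=P+s = Shifted⇒IsTranslateOf
    (Shifted-trans (map-Shifted t (subsetSums gZ))
    (Shifted-trans GZ=P+s
    (Shifted-trans (Shifted-by-zeroV (subsetSums-↭ (↭-sym prim-gZ↭gH)) (subsetSums-↭ prim-gZ↭gH))
                   (Shifted-by-zeroV ∈zonoPoints ∈subsetSums))))
    where
    ∈zonoPoints : ∀ {x} → x ∈ zonoPoints zeroV gH → x ∈ subsetSums gH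
    ∈zonoPoints x∈ with ∈-map⁻ (zeroV ⊕_) x∈
    ... | w , w∈ , ≡.refl = subst (_∈ _) (sym (⊕-identityˡ w)) w∈
    ∈subsetSums : ∀ {y} → y ∈ subsetSums gH → y ∈ zonoPoints zeroV gH
    ∈subsetSums {y} y∈ = subst (_∈ _) (⊕-identityˡ y) (∈-map⁺ (zeroV ⊕_) y∈)

  matching⇒translate : ∀ {d} (t : Pt d) (gZ gH : List (Pt d)) → ZonoGens gZ → Unique gH → Matching gZ gH →
    IsTranslateOf (zonoPoints t gZ) (zonoPoints zeroV gH)
  matching⇒translate t gZ gH (gZ≢0 , gZ-pairwise) gH! (forward , backward) = zonotope-translate t gZ gH signs prim-gZ↭gH
    where
    signs : All (λ g → g ≡ prim g ⊎ g ≡ neg (prim g)) gZ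
    signs = All.tabulate λ {g} g∈ → l1-prim≡l1⇒≡±prim g (All.lookup gZ≢0 g∈) (proj₂ (forward g∈))
    gZ! : Unique gZ
    gZ! = AllPairs.map (λ {x} x∦y x≡y → x∦y (subst (Collinear x) x≡y (+ 1 , + 1 , inj₁ (λ ()) , ≡.refl))) gZ-pairwise
    prim-injective : ∀ {x y} → x ∈ gZ → y ∈ gZ → prim x ≡ prim y → x ≡ y
    prim-injective {x} {y} x∈ y∈ px≡py with x ≟ᵥ y
    ... | yes x≡y = x≡y
    ... | no x≢y = ⊥-elim (AllPairs-∈ (λ x∦y y~x → x∦y (Collinear-sym y~x)) gZ-pairwise x∈ y∈ x≢y
                     (prim-≡⇒collinear x y (All.lookup gZ≢0 x∈) (All.lookup gZ≢0 y∈) px≡py))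
    into : ∀ {x} → x ∈ List.map prim gZ → x ∈ gH
    into x∈ with ∈-map⁻ prim x∈
    ... | g , g∈ , ≡.refl = proj₁ (forward g∈)
    onto : ∀ {x} → x ∈ gH → x ∈ List.map prim gZ
    onto x∈ with backward x∈
    ... | g , g∈ , ≡.refl = ∈-map⁺ prim g∈
    prim-gZ↭gH : List.map prim gZ ↭ gH
    prim-gZ↭gH = unique-⇔⇒↭ (Unique-map⁺ prim gZ! prim-injective) gH! into onto

module ZonotopeGraph where

  open import Defs
  open Vectors
  open Integers
  open SubsetSums
  open import Data.Nat as ℕ using (ℕ; zero; suc; z≤n; s≤s)
  import Data.Nat.Properties as ℕₚ
  open import Data.Integer as ℤ using (ℤ; +_; -[1+_]; 0ℤ; -_; _+_; _-_; _*_; _<_; _≤_; ∣_∣; +<+; +≤+)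
  import Data.Integer.Properties as ℤₚ
  open import Data.Integer.Tactic.RingSolver using (solve-∀)
  open import Data.Bool using (Bool; true; false; not)
  import Data.Bool
  open import Data.Fin as Fin using (Fin)
  import Data.Fin.Properties as Finₚ
  open import Data.Vec.Functional using (updateAt)
  open import Data.Vec.Functional.Properties using (updateAt-updates; updateAt-minimal; updateAt-id-local; updateAt-id; updateAt-updateAt)
  open import Data.List using (List; lookup; length)
  open import Data.List.Membership.Propositional using (_∈_)
  open import Data.List.Membership.Propositional.Properties using (∈-map⁺; ∈-map⁻; ∈-lookup)
  open import Data.List.Relation.Unary.All as All using (All)
  open ListFacts using (AllPairs-lookup)
  open import Data.Product using (Σ; ∃; _×_; _,_; proj₁; proj₂)
  open import Data.Sum using ([_,_]′)
  open import Data.Empty using (⊥; ⊥-elim)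
  open import Function using (_∘_)
  open import Relation.Nullary using (¬_; ¬?; Dec; yes; no; does; _×-dec_)
  open import Relation.Nullary.Decidable using (dec-true)
  open import Relation.Binary.PropositionalEquality

  module Zonotope {d n : ℕ} (S : List (Pt d)) (t : Pt d) (G : Fin n → Pt d)
    (∈S⇒point : ∀ {w} → w ∈ S → ∃ λ σ → w ≡ t ⊕ subsetSum G σ)
    (point∈S : ∀ σ → t ⊕ subsetSum G σ ∈ S)
    (G≢0 : ∀ i → G i ≢ zeroV)
    (G-noncollinear : ∀ i j → i ≢ j → ¬ Collinear (G i) (G j)) where

    point : (Fin n → Bool) → Pt d
    point σ = t ⊕ subsetSum G σ

    point-cong : ∀ {σ ρ} → (∀ i → σ i ≡ ρ i) → point σ ≡ point ρ
    point-cong σ≗ρ = cong (t ⊕_) (subsetSum-cong G σ≗ρ)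

    height : Pt d → Fin n → ℤ
    height c i = dot c (G i)

    value : Pt d → (Fin n → Bool) → ℤ
    value c σ = ∑ℤ (λ i → selectℤ (σ i) (height c i))

    dot-point : ∀ c σ → dot c (point σ) ≡ dot c t + value c σ
    dot-point c σ = trans (dot-distribʳ-⊕ c t _) (cong (λ v → dot c t + v) (dot-subsetSum c G σ))

    sign : Bool → ℤ
    sign true = + 1
    sign false = -[1+ 0 ]

    -- positive exactly when the choice σ i agrees with the sign of ⟨c, Gᵢ⟩
    margin : (Fin n → Bool) → Pt d → Fin n → ℤ
    margin σ c i = sign (σ i) * height c i

    Realizes : Pt d → (Fin n → Bool) → Set
    Realizes c σ = ∀ i → 0ℤ < margin σ c i

    WeaklyRealizes : Pt d → (Fin n → Bool) → Set
    WeaklyRealizes c σ = ∀ i → 0ℤ ≤ margin σ c i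

    Realizes⇒Weakly : ∀ c σ → Realizes c σ → WeaklyRealizes c σ
    Realizes⇒Weakly c σ realizes i = ℤₚ.<⇒≤ (realizes i)

    0<margin⇒height≢0 : ∀ σ c i → 0ℤ < margin σ c i → height c i ≢ 0ℤ
    0<margin⇒height≢0 σ c i 0<m h≡0 = ℤₚ.<-irrefl (sym (trans (cong (sign (σ i) *_) h≡0) (ℤₚ.*-zeroʳ (sign (σ i))))) 0<m

    private
      select-max : ∀ b′ h → 0ℤ ≤ sign b′ * h → ∀ b → selectℤ b h ≤ selectℤ b′ h
      select-max true h _ true = ℤₚ.≤-refl
      select-max true h 0≤h false = subst (0ℤ ≤_) (ℤₚ.*-identityˡ h) 0≤h
      select-max false h _ false = ℤₚ.≤-refl
      select-max false h 0≤-h true = ℤₚ.≤-trans (ℤₚ.≤-reflexive (sym (ℤₚ.neg-involutive h)))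
        (ℤₚ.neg-mono-≤ (subst (0ℤ ≤_) (ℤₚ.-1*i≡-i h) 0≤-h))

      select-injective : ∀ b b′ h → h ≢ 0ℤ → selectℤ b h ≡ selectℤ b′ h → b ≡ b′
      select-injective true true h _ _ = refl
      select-injective true false h h≢0 e = ⊥-elim (h≢0 e)
      select-injective false true h h≢0 e = ⊥-elim (h≢0 (sym e))
      select-injective false false h _ _ = refl

    value-max : ∀ c σ → WeaklyRealizes c σ → ∀ ρ → value c ρ ≤ value c σ
    value-max c σ weak ρ = ∑ℤ-mono-≤ (λ i → select-max (σ i) (height c i) (weak i) (ρ i))

    value-max-unique : ∀ c σ → WeaklyRealizes c σ → ∀ ρ → value c σ ≤ value c ρ → ∀ i → height c i ≢ 0ℤ → ρ i ≡ σ i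
    value-max-unique c σ weak ρ σ≤ρ i hᵢ≢0 =
      select-injective _ _ _ hᵢ≢0 (∑ℤ-tight (λ i → select-max (σ i) (height c i) (weak i) (ρ i)) σ≤ρ i)

    point-Maximizer : ∀ c σ → WeaklyRealizes c σ → Maximizer c S (point σ)
    point-Maximizer c σ weak = point∈S σ , dominated
      where
      dominated : ∀ u → u ∈ S → dot c u ≤ dot c (point σ)
      dominated u u∈S with ∈S⇒point u∈S
      ... | ρ , refl = subst₂ _≤_ (sym (dot-point c ρ)) (sym (dot-point c σ)) (ℤₚ.+-monoʳ-≤ (dot c t) (value-max c σ weak ρ))

    Maximizer⇒value-max : ∀ c {w} → Maximizer c S w → ∀ ρ → w ≡ point ρ → ∀ σ → value c σ ≤ value c ρ
    Maximizer⇒value-max c (_ , w-max) ρ refl σ =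
      +-cancelˡ-≤ (dot c t) (subst₂ _≤_ (dot-point c σ) (dot-point c ρ) (w-max (point σ) (point∈S σ)))

    Realizes⇒IsVertex : ∀ c σ → Realizes c σ → IsVertex S (point σ)
    Realizes⇒IsVertex c σ realizes = c , point-Maximizer c σ weak , unique
      where
      weak = Realizes⇒Weakly c σ realizes
      unique : ∀ w → Maximizer c S w → w ≡ point σ
      unique w w-max with ∈S⇒point (proj₁ w-max)
      ... | ρ , w≡ρ = trans w≡ρ (point-cong λ i → value-max-unique c σ weak ρ
                        (Maximizer⇒value-max c w-max ρ w≡ρ σ) i (0<margin⇒height≢0 σ c i (realizes i)))

    flip : (Fin n → Bool) → Fin n → Fin n → Bool
    flip ρ j = updateAt ρ j not

    value-updateAt : ∀ c ρ j f → height c j ≡ 0ℤ → value c (updateAt ρ j f) ≡ value c ρ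
    value-updateAt c ρ j f hⱼ≡0 = ∑ℤ-cong same
      where
      select-zero : ∀ b → selectℤ b 0ℤ ≡ 0ℤ
      select-zero true = refl
      select-zero false = refl
      same : ∀ i → selectℤ (updateAt ρ j f i) (height c i) ≡ selectℤ (ρ i) (height c i)
      same i with i Fin.≟ j
      ... | yes refl rewrite hⱼ≡0 = trans (select-zero _) (sym (select-zero (ρ i)))
      ... | no i≢j = cong (λ b → selectℤ b (height c i)) (updateAt-minimal i j ρ i≢j)

    Maximizer-flip : ∀ c ρ j → Maximizer c S (point ρ) → height c j ≡ 0ℤ → Maximizer c S (point (flip ρ j))
    Maximizer-flip c ρ j (_ , ρ-max) hⱼ≡0 = point∈S (flip ρ j) , λ u u∈S → subst (dot c u ≤_) same (ρ-max u u∈S)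
      where
      same : dot c (point ρ) ≡ dot c (point (flip ρ j))
      same = trans (dot-point c ρ) (trans (cong (λ v → dot c t + v) (sym (value-updateAt c ρ j not hⱼ≡0))) (sym (dot-point c (flip ρ j))))

    private
      rest : (Fin n → Bool) → Fin n → Pt d
      rest ρ j = subsetSum G (updateAt ρ j (λ _ → false))

      point-chosen : ∀ ρ j → ρ j ≡ true → point ρ ≡ t ⊕ (G j ⊕ rest ρ j)
      point-chosen ρ j ρⱼ = cong (t ⊕_) (trans (subsetSum-cong G (λ i → sym (updateAt-id-local j ρ (sym ρⱼ) i)))
                                                (subsetSum-updateAt G ρ j))

      point-unchosen : ∀ ρ j → ρ j ≡ false → point ρ ≡ t ⊕ rest ρ j
      point-unchosen ρ j ρⱼ = point-cong (λ i → sym (updateAt-id-local j ρ (sym ρⱼ) i))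

      rest-flip : ∀ ρ j → rest (flip ρ j) j ≡ rest ρ j
      rest-flip ρ j = subsetSum-cong G (updateAt-updateAt j ρ)

    point-flip : ∀ ρ j → ∃ λ s → s ≢ 0ℤ × point (flip ρ j) ⊖ point ρ ≡ scale s (G j)
    point-flip ρ j with ρ j in ρⱼ
    ... | true = -[1+ 0 ] , (λ ()) , (begin
      point (flip ρ j) ⊖ point ρ                 ≡⟨ cong₂ _⊖_ (trans (point-unchosen (flip ρ j) j flipped) (cong (t ⊕_) (rest-flip ρ j)))
                                                                (point-chosen ρ j ρⱼ) ⟩
      (t ⊕ rest ρ j) ⊖ (t ⊕ (G j ⊕ rest ρ j))    ≡⟨ [t⊕x]⊖[t⊕[g⊕x]]≡neg[g] t (G j) (rest ρ j) ⟩
      neg (G j)                                  ≡⟨ scale-[-1]≡neg (G j) ⟨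
      scale -[1+ 0 ] (G j)                       ∎)
      where
      open ≡-Reasoning
      flipped : flip ρ j j ≡ false
      flipped = trans (updateAt-updates j ρ) (cong not ρⱼ)
    ... | false = + 1 , (λ ()) , (begin
      point (flip ρ j) ⊖ point ρ                 ≡⟨ cong₂ _⊖_ (trans (point-chosen (flip ρ j) j flipped) (cong (λ x → t ⊕ (G j ⊕ x)) (rest-flip ρ j)))
                                                                (point-unchosen ρ j ρⱼ) ⟩
      (t ⊕ (G j ⊕ rest ρ j)) ⊖ (t ⊕ rest ρ j)    ≡⟨ [t⊕[g⊕x]]⊖[t⊕x]≡g t (G j) (rest ρ j) ⟩
      G j                                        ≡⟨ scale-identityˡ (G j) ⟨
      scale (+ 1) (G j)                          ∎)
      where
      open ≡-Reasoning
      flipped : flip ρ j j ≡ true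
      flipped = trans (updateAt-updates j ρ) (cong not ρⱼ)

    point-flip-≢ : ∀ ρ j → point (flip ρ j) ≢ point ρ
    point-flip-≢ ρ j e with point-flip ρ j
    ... | s , s≢0 , diff = G≢0 j (scale≡zeroV⇒≡zeroV s (G j) s≢0 (trans (sym diff) (trans (cong (_⊖ point ρ) e) (⊖-self (point ρ)))))

    positivePart : Pt d → Fin n → Bool
    positivePart c i = does (0ℤ ℤ.<? height c i)

    positivePart-weak : ∀ c → WeaklyRealizes c (positivePart c)
    positivePart-weak c i with 0ℤ ℤ.<? height c i
    ... | yes h>0 = subst (0ℤ ≤_) (sym (ℤₚ.*-identityˡ (height c i))) (ℤₚ.<⇒≤ h>0)
    ... | no h≯0 = subst (0ℤ ≤_) (sym (ℤₚ.-1*i≡-i (height c i))) (ℤₚ.neg-mono-≤ (ℤₚ.≮⇒≥ h≯0))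

    positivePart-margin : ∀ c i → height c i ≢ 0ℤ → 0ℤ < margin (positivePart c) c i
    positivePart-margin c i h≢0 with 0ℤ ℤ.<? height c i
    ... | yes h>0 = subst (0ℤ <_) (sym (ℤₚ.*-identityˡ (height c i))) h>0
    ... | no h≯0 = subst (0ℤ <_) (sym (ℤₚ.-1*i≡-i (height c i)))
                     (ℤₚ.neg-mono-< ([ (λ h>0 → ⊥-elim (h≯0 h>0)) , (λ h<0 → h<0) ]′ (≢0⇒>0∨<0 (height c i) h≢0)))

    Maximizer-agrees : ∀ c {w} → Maximizer c S w → ∀ ρ → w ≡ point ρ → ∀ i → height c i ≢ 0ℤ → ρ i ≡ positivePart c i
    Maximizer-agrees c w-max ρ w≡ρ = value-max-unique c (positivePart c) (positivePart-weak c) ρ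
      (Maximizer⇒value-max c w-max ρ w≡ρ (positivePart c))

    record VertexData (v : Pt d) : Set where
      field
        σ : Fin n → Bool
        c : Pt d
        realizes : Realizes c σ
        v≡point : v ≡ point σ
        unique : ∀ ρ → v ≡ point ρ → ∀ i → ρ i ≡ σ i

    -- A functional exposing a single point of S cannot be orthogonal to a generator,
    -- since flipping that generator would give a second maximiser.
    IsVertex⇒VertexData : ∀ {v} → IsVertex S v → VertexData v
    IsVertex⇒VertexData {v} (c , v-max , v-unique) with ∈S⇒point (proj₁ v-max)
    ... | ρ , v≡ρ = record
      { σ = ρ ; c = c ; realizes = realizes ; v≡point = v≡ρ
      ; unique = λ ρ′ v≡ρ′ i → value-max-unique c ρ (Realizes⇒Weakly c ρ realizes) ρ′
                                 (Maximizer⇒value-max c v-max ρ′ v≡ρ′ ρ) i (height≢0 i) }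
      where
      height≢0 : ∀ i → height c i ≢ 0ℤ
      height≢0 i hᵢ≡0 = point-flip-≢ ρ i (trans (v-unique _ (Maximizer-flip c ρ i (subst (Maximizer c S) v≡ρ v-max) hᵢ≡0)) v≡ρ)
      realizes : Realizes c ρ
      realizes i = subst (λ b → 0ℤ < sign b * height c i) (sym (Maximizer-agrees c v-max ρ v≡ρ i (height≢0 i)))
                     (positivePart-margin c i (height≢0 i))

    -- The two ends of an edge differ in at most one generator: two differing generators would
    -- both be parallel to the edge.
    edge⇒hamming≤1 : ∀ {u w} → IsEdge S u w → ∀ ρ ρ′ → u ≡ point ρ → w ≡ point ρ′ → hamming ρ ρ′ ℕ.≤ 1
    edge⇒hamming≤1 {u} {w} (_ , _ , _ , c , u-max , w-max , on-segment) ρ ρ′ u≡ρ w≡ρ′ = hamming≤1 ρ ρ′ two-differences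
      where
      height≡0 : ∀ j → ρ j ≢ ρ′ j → height c j ≡ 0ℤ
      height≡0 j ρⱼ≢ρ′ⱼ with height c j ℤ.≟ 0ℤ
      ... | yes hⱼ≡0 = hⱼ≡0
      ... | no hⱼ≢0 = ⊥-elim (ρⱼ≢ρ′ⱼ (trans (Maximizer-agrees c u-max ρ u≡ρ j hⱼ≢0)
                                          (sym (Maximizer-agrees c w-max ρ′ w≡ρ′ j hⱼ≢0))))
      parallel : ∀ j → ρ j ≢ ρ′ j → Σ ℤ λ α → Σ ℤ λ a → α ≢ 0ℤ × scale α (G j) ≡ scale a (w ⊖ u)
      parallel j ρⱼ≢ρ′ⱼ with on-segment _ (Maximizer-flip c ρ j (subst (Maximizer c S) u≡ρ u-max) (height≡0 j ρⱼ≢ρ′ⱼ)) | point-flip ρ j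
      ... | a , b , b>0 , _ , b·Δ≡a·e | s , s≢0 , Δ≡s·Gⱼ = + b * s , + a , b·s≢0 , (begin
        scale (+ b * s) (G j)                ≡⟨ scale-∘ (+ b) s (G j) ⟨
        scale (+ b) (scale s (G j))          ≡⟨ cong (scale (+ b)) Δ≡s·Gⱼ ⟨
        scale (+ b) (point (flip ρ j) ⊖ point ρ) ≡⟨ cong (λ x → scale (+ b) (point (flip ρ j) ⊖ x)) u≡ρ ⟨
        scale (+ b) (point (flip ρ j) ⊖ u)   ≡⟨ b·Δ≡a·e ⟩
        scale (+ a) (w ⊖ u)                  ∎)
        where
        open ≡-Reasoning
        b·s≢0 : + b * s ≢ 0ℤ
        b·s≢0 e = [ (λ b≡0 → ℕₚ.<⇒≢ b>0 (sym (ℤₚ.+-injective b≡0))) , s≢0 ]′ (ℤₚ.i*j≡0⇒i≡0∨j≡0 (+ b) e)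
      two-differences : ∀ j k → j ≢ k → ρ j ≢ ρ′ j → ρ k ≢ ρ′ k → ⊥
      two-differences j k j≢k ρⱼ≢ρ′ⱼ ρₖ≢ρ′ₖ with parallel j ρⱼ≢ρ′ⱼ | parallel k ρₖ≢ρ′ₖ
      ... | α , a , α≢0 , eⱼ | β , b , β≢0 , eₖ = G-noncollinear j k j≢k (parallel⇒collinear {a = a} {b = b} α≢0 β≢0 (G≢0 k) eⱼ eₖ)

    walk⇒hamming≤length : ∀ {u v m} → Walk S u v m → ∀ ρ ρ′ → u ≡ point ρ → v ≡ point ρ′ → hamming ρ ρ′ ℕ.≤ m
    walk⇒hamming≤length (here v-vertex) ρ ρ′ v≡ρ v≡ρ′ =
      ℕₚ.≤-reflexive (hamming-≗ ρ ρ′ (λ i → trans (VertexData.unique data′ ρ v≡ρ i) (sym (VertexData.unique data′ ρ′ v≡ρ′ i))))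
      where data′ = IsVertex⇒VertexData v-vertex
    walk⇒hamming≤length (step edge walk) ρ ρ′ u≡ρ v≡ρ′ with ∈S⇒point (proj₁ (proj₁ (proj₂ (proj₁ (proj₂ edge)))))
    ... | τ , w≡τ = ℕₚ.≤-trans (hamming-triangle ρ τ ρ′)
      (ℕₚ.+-mono-≤ (edge⇒hamming≤1 edge ρ τ u≡ρ w≡τ) (walk⇒hamming≤length walk τ ρ′ w≡τ v≡ρ′))

    private
      sign-nonzero : ∀ b → sign b ≢ 0ℤ
      sign-nonzero true ()
      sign-nonzero false ()

      sign*sign : ∀ b → sign b * sign b ≡ + 1
      sign*sign true = refl
      sign*sign false = refl

      ∣sign*x∣ : ∀ b x → ∣ sign b * x ∣ ≡ ∣ x ∣
      ∣sign*x∣ true x = cong ∣_∣ (ℤₚ.*-identityˡ x)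
      ∣sign*x∣ false x = trans (cong ∣_∣ (ℤₚ.-1*i≡-i x)) (ℤₚ.∣-i∣≡∣i∣ x)

      term<1+∑ : ∀ (f : Fin n → ℤ) i → ∣ f i ∣ ℕ.< suc (∑ℕ (λ k → ∣ f k ∣))
      term<1+∑ f i = s≤s (term≤∑ℕ (λ k → ∣ f k ∣) i)

    height-linear : ∀ α c₁ c₂ i → height (scale α c₁ ⊕ c₂) i ≡ α * height c₁ i + height c₂ i
    height-linear α c₁ c₂ i = trans (dot-distribˡ-⊕ (scale α c₁) c₂ (G i)) (cong (_+ height c₂ i) (dot-scaleˡ α c₁ (G i)))

    margin-linear : ∀ σ α c₁ c₂ i → margin σ (scale α c₁ ⊕ c₂) i ≡ α * margin σ c₁ i + margin σ c₂ i
    margin-linear σ α c₁ c₂ i = trans (cong (sign (σ i) *_) (height-linear α c₁ c₂ i)) (distribute (sign (σ i)) α (height c₁ i) (height c₂ i))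
      where
      distribute : ∀ (s α x y : ℤ) → s * (α * x + y) ≡ α * (s * x) + s * y
      distribute = solve-∀

    margin≡0⇒height≡0 : ∀ σ c i → margin σ c i ≡ 0ℤ → height c i ≡ 0ℤ
    margin≡0⇒height≡0 σ c i m≡0 =
      [ (λ s≡0 → ⊥-elim (sign-nonzero (σ i) s≡0)) , (λ h≡0 → h≡0) ]′ (ℤₚ.i*j≡0⇒i≡0∨j≡0 (sign (σ i)) m≡0)

    height≡0⇒margin≡0 : ∀ σ c i → height c i ≡ 0ℤ → margin σ c i ≡ 0ℤ
    height≡0⇒margin≡0 σ c i h≡0 = trans (cong (sign (σ i) *_) h≡0) (ℤₚ.*-zeroʳ (sign (σ i)))

    module OnWall (w : Pt d) (j : Fin n) (σ : Fin n → Bool)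
      (on-wall : height w j ≡ 0ℤ) (off-wall : ∀ i → i ≢ j → 0ℤ < margin σ w i) where

      K : ℕ
      K = suc (∑ℕ (λ i → ∣ dot (G j) (G i) ∣))

      -- Tilting w by ±Gⱼ exposes either end of the edge alone.
      tilt : (Bool → Bool) → Pt d
      tilt f = scale (+ K) w ⊕ scale (sign (f (σ j))) (G j)

      tilt-realizes : ∀ f → Realizes (tilt f) (updateAt σ j f)
      tilt-realizes f i with i Fin.≟ j
      ... | yes refl rewrite updateAt-updates i {f} σ | height-linear (+ K) w (scale (sign (f (σ i))) (G i)) i
                           | on-wall | dot-scaleˡ (sign (f (σ i))) (G i) (G i) =
        subst (0ℤ <_) (sym (square (sign (f (σ i))) (+ K) (dot (G i) (G i)) (sign*sign (f (σ i))))) (0<dot-self (G i) (G≢0 i))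
        where
        square : ∀ (s k x : ℤ) → s * s ≡ + 1 → s * (k * 0ℤ + s * x) ≡ x
        square s k x s²≡1 = trans (expand s k x) (trans (cong (_* x) s²≡1) (ℤₚ.*-identityˡ x))
          where
          expand : ∀ (s k x : ℤ) → s * (k * 0ℤ + s * x) ≡ s * s * x
          expand = solve-∀
      ... | no i≢j rewrite updateAt-minimal i j {f} σ i≢j | margin-linear σ (+ K) w (scale (sign (f (σ j))) (G j)) i =
        K*x+e>0 K (margin σ w i) _ (off-wall i i≢j) (subst (ℕ._< K) (sym ∣perturbation∣) (term<1+∑ (λ k → dot (G j) (G k)) i))
        where
        ∣perturbation∣ : ∣ sign (σ i) * height (scale (sign (f (σ j))) (G j)) i ∣ ≡ ∣ dot (G j) (G i) ∣
        ∣perturbation∣ = trans (∣sign*x∣ (σ i) _) (trans (cong ∣_∣ (dot-scaleˡ (sign (f (σ j))) (G j) (G i))) (∣sign*x∣ (f (σ j)) _))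

      weakly-realizes : ∀ ρ → (∀ i → i ≢ j → ρ i ≡ σ i) → WeaklyRealizes w ρ
      weakly-realizes ρ ρ≈σ i with i Fin.≟ j
      ... | yes refl = ℤₚ.≤-reflexive (sym (height≡0⇒margin≡0 ρ w i on-wall))
      ... | no i≢j = subst (λ b → 0ℤ ≤ sign b * height w i) (sym (ρ≈σ i i≢j)) (ℤₚ.<⇒≤ (off-wall i i≢j))

      maximizer-off-wall : ∀ {x} → Maximizer w S x → ∀ ρ → x ≡ point ρ → ∀ i → i ≢ j → ρ i ≡ σ i
      maximizer-off-wall x-max ρ x≡ρ i i≢j = value-max-unique w σ (weakly-realizes σ (λ _ _ → refl)) ρ
        (Maximizer⇒value-max w x-max ρ x≡ρ σ) i (0<margin⇒height≢0 σ w i (off-wall i i≢j))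

      on-segment : ∀ x → Maximizer w S x → OnSegment (point σ) (point (flip σ j)) x
      on-segment x x-max with ∈S⇒point (proj₁ x-max)
      ... | ρ , x≡ρ with ρ j Data.Bool.≟ σ j
      ...   | yes ρⱼ≡σⱼ = 0 , 1 , s≤s z≤n , z≤n , (begin
        scale (+ 1) (x ⊖ point σ)              ≡⟨ cong (λ y → scale (+ 1) (y ⊖ point σ)) (trans x≡ρ (point-cong agree)) ⟩
        scale (+ 1) (point σ ⊖ point σ)        ≡⟨ cong (scale (+ 1)) (⊖-self (point σ)) ⟩
        scale (+ 1) zeroV                      ≡⟨ scale-zeroʳ (+ 1) ⟩
        zeroV                                  ≡⟨ scale-zeroˡ _ ⟨
        scale 0ℤ (point (flip σ j) ⊖ point σ)  ∎)
        where
        open ≡-Reasoning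
        agree : ∀ i → ρ i ≡ σ i
        agree i with i Fin.≟ j
        ... | yes refl = ρⱼ≡σⱼ
        ... | no i≢j = maximizer-off-wall x-max ρ x≡ρ i i≢j
      ...   | no ρⱼ≢σⱼ = 1 , 1 , s≤s z≤n , s≤s z≤n , cong (λ y → scale (+ 1) (y ⊖ point σ)) (trans x≡ρ (point-cong agree))
        where
        not-≢ : ∀ {a b} → a ≢ b → a ≡ not b
        not-≢ {true} {true} a≢b = ⊥-elim (a≢b refl)
        not-≢ {true} {false} _ = refl
        not-≢ {false} {true} _ = refl
        not-≢ {false} {false} a≢b = ⊥-elim (a≢b refl)
        agree : ∀ i → ρ i ≡ flip σ j i
        agree i with i Fin.≟ j
        ... | yes refl = trans (not-≢ ρⱼ≢σⱼ) (sym (updateAt-updates i σ))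
        ... | no i≢j = trans (maximizer-off-wall x-max ρ x≡ρ i i≢j) (sym (updateAt-minimal i j σ i≢j))

      edge : IsEdge S (point σ) (point (flip σ j))
      edge = vertex-σ , Realizes⇒IsVertex (tilt not) (flip σ j) (tilt-realizes not) , point-flip-≢ σ j ∘ sym ,
             w , point-Maximizer w σ (weakly-realizes σ (λ _ _ → refl)) ,
             point-Maximizer w (flip σ j) (weakly-realizes (flip σ j) (λ i i≢j → updateAt-minimal i j σ i≢j)) , on-segment
        where
        vertex-σ : IsVertex S (point σ)
        vertex-σ = subst (IsVertex S) (point-cong (updateAt-id j σ))
          (Realizes⇒IsVertex (tilt (λ b → b)) (updateAt σ j (λ b → b)) (tilt-realizes (λ b → b)))

    margin-scale : ∀ σ a c i → margin σ (scale a c) i ≡ a * margin σ c i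
    margin-scale σ a c i = trans (cong (sign (σ i) *_) (dot-scaleˡ a c (G i))) (commute (sign (σ i)) a (height c i))
      where
      commute : ∀ (s a h : ℤ) → s * (a * h) ≡ a * (s * h)
      commute = solve-∀

    private
      does-true : ∀ {A : Set} (a? : Dec A) → does a? ≡ true → A
      does-true (yes a) _ = a

      does-false : ∀ {A : Set} (a? : Dec A) → does a? ≡ false → ¬ A
      does-false (no ¬a) _ = ¬a

    -- Walking from c₁ (which selects σ on M) towards c₂, the walls Gᵢ⊥ with i ∈ T are the first
    -- to be crossed; cs lies on all of them and still strictly selects σ on the rest of M.
    record FirstWall (σ M : Fin n → Bool) (c₂ : Pt d) : Set where
      field
        cs : Pt d
        T : Fin n → Bool
        T⊆M : ∀ i → T i ≡ true → M i ≡ true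
        T-crossed : ∀ i → T i ≡ true → margin σ c₂ i ≤ 0ℤ
        k : Fin n
        k∈T : T k ≡ true
        on-walls : ∀ i → T i ≡ true → height cs i ≡ 0ℤ
        off-walls : ∀ i → M i ≡ true → T i ≡ false → 0ℤ < margin σ cs i

    module Crossing (σ M : Fin n → Bool) (c₁ c₂ : Pt d) (c₁-selects : ∀ i → M i ≡ true → 0ℤ < margin σ c₁ i)
      (i₀ : Fin n) (i₀∈M : M i₀ ≡ true) (i₀-crossed : margin σ c₂ i₀ ≤ 0ℤ) where

      A E : Fin n → ℕ
      A i = ∣ margin σ c₁ i ∣
      E i = ∣ margin σ c₂ i ∣

      A>0 : ∀ i → M i ≡ true → 0 ℕ.< A i
      A>0 i i∈M with margin σ c₁ i | c₁-selects i i∈M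
      ... | + suc _ | _ = s≤s z≤n
      ... | + 0 | +<+ ()

      Crossed : Fin n → Set
      Crossed i = M i ≡ true × margin σ c₂ i ≤ 0ℤ

      -- i is crossed no later than k: the wall of Gᵢ is met at parameter Aᵢ / (Aᵢ + Eᵢ).
      _≼_ : Fin n → Fin n → Set
      i ≼ k = E i ℕ.* A k ℕ.≤ E k ℕ.* A i

      ≼-trans : ∀ {i j k} → Crossed j → i ≼ j → j ≼ k → i ≼ k
      ≼-trans {i} {j} {k} (j∈M , _) = ratio-≤-trans (E i) (E j) (E k) (A i) (A j) (A k) (A>0 j j∈M)

      last : ∃ λ k → Crossed k × (∀ i → Crossed i → i ≼ k)
      last = argmax _≼_ (λ i → (M i Data.Bool.≟ true) ×-dec (margin σ c₂ i ℤ.≤? 0ℤ))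
        (λ i k → ℕₚ.≤-total (E i ℕ.* A k) (E k ℕ.* A i)) ≼-trans (i₀ , i₀∈M , i₀-crossed)

      k : Fin n
      k = proj₁ last

      k-crossed : Crossed k
      k-crossed = proj₁ (proj₂ last)

      k-last : ∀ i → Crossed i → i ≼ k
      k-last = proj₂ (proj₂ last)

      cs : Pt d
      cs = scale (+ E k) c₁ ⊕ scale (+ A k) c₂

      margin-cs : ∀ i → margin σ cs i ≡ + E k * margin σ c₁ i + + A k * margin σ c₂ i
      margin-cs i = trans (margin-linear σ (+ E k) c₁ (scale (+ A k) c₂) i)
        (cong (λ x → + E k * margin σ c₁ i + x) (margin-scale σ (+ A k) c₂ i))

      margin-cs-crossed : ∀ i → Crossed i → margin σ cs i ≡ + (E k ℕ.* A i) - + (E i ℕ.* A k)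
      margin-cs-crossed i (i∈M , crossed) = begin
        margin σ cs i                                 ≡⟨ margin-cs i ⟩
        + E k * margin σ c₁ i + + A k * margin σ c₂ i ≡⟨ cong₂ (λ x y → + E k * x + + A k * y) m₁≡Aᵢ m₂≡-Eᵢ ⟩
        + E k * + A i + + A k * - (+ E i)             ≡⟨ rearrange (+ E k) (+ A i) (+ A k) (+ E i) ⟩
        + E k * + A i - + E i * + A k                 ≡⟨ cong₂ _-_ (ℤₚ.pos-* (E k) (A i)) (ℤₚ.pos-* (E i) (A k)) ⟨
        + (E k ℕ.* A i) - + (E i ℕ.* A k)             ∎
        where
        open ≡-Reasoning
        m₁≡Aᵢ : margin σ c₁ i ≡ + A i
        m₁≡Aᵢ = sym (ℤₚ.0≤i⇒+∣i∣≡i (ℤₚ.<⇒≤ (c₁-selects i i∈M)))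
        m₂≡-Eᵢ : margin σ c₂ i ≡ - (+ E i)
        m₂≡-Eᵢ = trans (sym (ℤₚ.neg-involutive _))
          (cong -_ (trans (sym (ℤₚ.0≤i⇒+∣i∣≡i (ℤₚ.neg-mono-≤ crossed))) (cong +_ (ℤₚ.∣-i∣≡∣i∣ (margin σ c₂ i)))))
        rearrange : ∀ (ek ai ak ei : ℤ) → ek * ai + ak * - ei ≡ ek * ai - ei * ak
        rearrange = solve-∀

      margin-cs-uncrossed : ∀ i → M i ≡ true → 0ℤ < margin σ c₂ i → 0ℤ < margin σ cs i
      margin-cs-uncrossed i i∈M uncrossed = subst (0ℤ <_) (sym (margin-cs i))
        (ℤₚ.+-mono-≤-< {0ℤ} {+ E k * margin σ c₁ i}
          (subst (_≤ + E k * margin σ c₁ i) (ℤₚ.*-zeroʳ (+ E k)) (ℤₚ.*-monoˡ-≤-nonNeg (+ E k) (ℤₚ.<⇒≤ (c₁-selects i i∈M))))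
          (0<+a*b (A>0 k (proj₁ k-crossed)) uncrossed))
        where
        0<+a*b : ∀ {a b} → 0 ℕ.< a → 0ℤ < b → 0ℤ < + a * b
        0<+a*b {suc a} {+ suc b} _ _ = +<+ (s≤s z≤n)
        0<+a*b {suc a} {+ 0} _ (+<+ ())

      T? : ∀ i → Dec (M i ≡ true × margin σ cs i ≡ 0ℤ)
      T? i = (M i Data.Bool.≟ true) ×-dec (margin σ cs i ℤ.≟ 0ℤ)

      T : Fin n → Bool
      T i = does (T? i)

      T-sound : ∀ i → T i ≡ true → M i ≡ true × margin σ cs i ≡ 0ℤ
      T-sound i = does-true (T? i)

      T-crossed : ∀ i → T i ≡ true → margin σ c₂ i ≤ 0ℤ
      T-crossed i i∈T with T-sound i i∈T
      ... | i∈M , m≡0 = ℤₚ.≮⇒≥ (λ uncrossed → ℤₚ.<-irrefl (sym m≡0) (margin-cs-uncrossed i i∈M uncrossed))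

      k∈T : T k ≡ true
      k∈T = dec-true (T? k) (proj₁ k-crossed , trans (margin-cs-crossed k k-crossed) (ℤₚ.+-inverseʳ (+ (E k ℕ.* A k))))

      off-walls : ∀ i → M i ≡ true → T i ≡ false → 0ℤ < margin σ cs i
      off-walls i i∈M i∉T with margin σ c₂ i ℤ.≤? 0ℤ
      ... | no uncrossed = margin-cs-uncrossed i i∈M (ℤₚ.≰⇒> uncrossed)
      ... | yes crossed = ℤₚ.≤∧≢⇒< 0≤m (λ 0≡m → does-false (T? i) i∉T (i∈M , sym 0≡m))
        where
        0≤m : 0ℤ ≤ margin σ cs i
        0≤m = subst (0ℤ ≤_) (sym (margin-cs-crossed i (i∈M , crossed))) (ℤₚ.i≤j⇒0≤j-i (+≤+ (k-last i (i∈M , crossed))))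

    first-wall : ∀ σ M c₁ c₂ → (∀ i → M i ≡ true → 0ℤ < margin σ c₁ i) →
      ∀ i₀ → M i₀ ≡ true → margin σ c₂ i₀ ≤ 0ℤ → FirstWall σ M c₂
    first-wall σ M c₁ c₂ c₁-selects i₀ i₀∈M i₀-crossed = record
      { cs = cs ; T = T ; T⊆M = λ i i∈T → proj₁ (T-sound i i∈T) ; T-crossed = T-crossed ; k = k ; k∈T = k∈T
      ; on-walls = λ i i∈T → margin≡0⇒height≡0 σ cs i (proj₂ (T-sound i i∈T))
      ; off-walls = off-walls }
      where open Crossing σ M c₁ c₂ c₁-selects i₀ i₀∈M i₀-crossed

    record Wall (σ M : Fin n → Bool) : Set where
      field
        j : Fin n
        j∈M : M j ≡ true
        w : Pt d
        on-wall : height w j ≡ 0ℤ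
        off-wall : ∀ i → M i ≡ true → i ≢ j → 0ℤ < margin σ w i

    -- K cs + w′ with K large: cs selects σ on M ∖ T, and w′ on T ∖ {j}.
    refine : ∀ {σ M c₂} (F : FirstWall σ M c₂) → Wall σ (FirstWall.T F) → Wall σ M
    refine {σ} {M} F W = record
      { j = j ; j∈M = T⊆M j j∈T ; w = w ; on-wall = on-wall ; off-wall = off-wall }
      where
      open FirstWall F
      open Wall W renaming (w to w′; on-wall to w′-on-wall; off-wall to w′-off-wall; j∈M to j∈T)
      K : ℕ
      K = suc (∑ℕ (λ i → ∣ margin σ w′ i ∣))
      w = scale (+ K) cs ⊕ w′
      on-wall : height w j ≡ 0ℤ
      on-wall = trans (height-linear (+ K) cs w′ j)
        (trans (cong₂ (λ x y → + K * x + y) (on-walls j j∈T) w′-on-wall) (trans (ℤₚ.+-identityʳ _) (ℤₚ.*-zeroʳ (+ K))))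
      off-wall : ∀ i → M i ≡ true → i ≢ j → 0ℤ < margin σ w i
      off-wall i i∈M i≢j with T i in Tᵢ
      ... | true = subst (0ℤ <_) (sym (trans (margin-linear σ (+ K) cs w′ i)
                     (trans (cong (λ x → + K * x + margin σ w′ i) (height≡0⇒margin≡0 σ cs i (on-walls i Tᵢ)))
                       (trans (cong (_+ margin σ w′ i) (ℤₚ.*-zeroʳ (+ K))) (ℤₚ.+-identityˡ _)))))
                     (w′-off-wall i Tᵢ i≢j)
      ... | false = subst (0ℤ <_) (sym (margin-linear σ (+ K) cs w′ i))
                      (K*x+e>0 K (margin σ cs i) (margin σ w′ i) (off-walls i i∈M Tᵢ) (term<1+∑ (margin σ w′) i))

    FirstWall-narrower : ∀ {σ M c₂} (F : FirstWall σ M c₂) → ∀ k₀ → M k₀ ≡ true → 0ℤ < margin σ c₂ k₀ →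
      count (FirstWall.T F) ℕ.< count M
    FirstWall-narrower F k₀ k₀∈M k₀-ahead = count-mono-< T _ T⊆M k₀ k₀∉T k₀∈M
      where
      open FirstWall F
      k₀∉T : T k₀ ≡ false
      k₀∉T with T k₀ in Tₖ₀
      ... | false = refl
      ... | true = ⊥-elim (ℤₚ.<⇒≱ k₀-ahead (T-crossed k₀ Tₖ₀))

    -- Induction on |M|: if M has an element k₀ besides j₀, tilt c₁ towards a functional vanishing
    -- on G_{j₀} but not on G_{k₀}; the first walls crossed form a smaller subset of M.
    single-wall : ∀ fuel σ M c₁ → count M ℕ.≤ fuel → (∀ i → M i ≡ true → 0ℤ < margin σ c₁ i) →
      ∀ j₀ → M j₀ ≡ true → Wall σ M
    single-wall zero σ M c₁ |M|≤0 _ j₀ j₀∈M = ⊥-elim (ℕₚ.<-irrefl refl (ℕₚ.<-≤-trans (count-pos M j₀ j₀∈M) |M|≤0))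
    single-wall (suc fuel) σ M c₁ |M|≤ c₁-selects j₀ j₀∈M
      with Finₚ.any? (λ k → (M k Data.Bool.≟ true) ×-dec ¬? (k Fin.≟ j₀))
    ... | no alone = record { j = j₀ ; j∈M = j₀∈M ; w = zeroV ; on-wall = dot-zeroˡ (G j₀)
                            ; off-wall = λ i i∈M i≢j₀ → ⊥-elim (alone (i , i∈M , i≢j₀)) }
    ... | yes (k₀ , k₀∈M , k₀≢j₀) = refine F (single-wall fuel σ T c₁ |T|≤fuel (λ i i∈T → c₁-selects i (T⊆M i i∈T)) k k∈T)
      where
      separating = separating-functional (G j₀) (G k₀) (G≢0 j₀) (G-noncollinear j₀ k₀ (k₀≢j₀ ∘ sym))
      w₀ = proj₁ separating
      e = margin σ w₀ k₀
      e≢0 : e ≢ 0ℤ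
      e≢0 e≡0 = proj₂ (proj₂ separating) (margin≡0⇒height≡0 σ w₀ k₀ e≡0)
      c₂ = scale e w₀
      F = first-wall σ M c₁ c₂ c₁-selects j₀ j₀∈M
            (ℤₚ.≤-reflexive (trans (margin-scale σ e w₀ j₀)
              (trans (cong (e *_) (height≡0⇒margin≡0 σ w₀ j₀ (proj₁ (proj₂ separating)))) (ℤₚ.*-zeroʳ e))))
      open FirstWall F using (T; T⊆M; k; k∈T)
      |T|≤fuel : count T ℕ.≤ fuel
      |T|≤fuel = ℕₚ.≤-pred (ℕₚ.≤-trans (FirstWall-narrower F k₀ k₀∈M (subst (0ℤ <_) (sym (margin-scale σ e w₀ k₀)) (0<a*a e e≢0))) |M|≤)

    Path : (Fin n → Bool) → (Fin n → Bool) → Set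
    Path σ τ = ∃ λ m → m ℕ.≤ hamming σ τ × Walk S (point σ) (point τ) m

    private
      sign-opposite : ∀ {a b} → a ≢ b → sign a ≡ - sign b
      sign-opposite {true} {true} a≢b = ⊥-elim (a≢b refl)
      sign-opposite {true} {false} _ = refl
      sign-opposite {false} {true} _ = refl
      sign-opposite {false} {false} a≢b = ⊥-elim (a≢b refl)

    -- Cross the first wall met on the way from c₁ to c₂: it separates σ from τ and is an edge.
    path : ∀ fuel σ τ c₁ c₂ → hamming σ τ ℕ.≤ fuel → Realizes c₁ σ → Realizes c₂ τ → Path σ τ
    path fuel σ τ c₁ c₂ _ _ c₂-τ with Finₚ.all? (λ i → σ i Data.Bool.≟ τ i)
    ... | yes σ≗τ = 0 , z≤n , subst (λ x → Walk S x (point τ) 0) (sym (point-cong σ≗τ)) (here (Realizes⇒IsVertex c₂ τ c₂-τ))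
    path fuel σ τ c₁ c₂ h≤fuel c₁-σ c₂-τ | no σ≉τ with Finₚ.¬∀⟶∃¬ _ _ (λ i → σ i Data.Bool.≟ τ i) σ≉τ
    path zero σ τ c₁ c₂ h≤0 c₁-σ c₂-τ | no _ | i₀ , σᵢ₀≢τᵢ₀ =
      ⊥-elim (ℕₚ.n≮0 (subst (ℕ._≤ 0) (hamming-flip σ τ i₀ σᵢ₀≢τᵢ₀) h≤0))
    path (suc fuel) σ τ c₁ c₂ h≤fuel c₁-σ c₂-τ | no _ | i₀ , σᵢ₀≢τᵢ₀ =
      suc (proj₁ onward) , ℕₚ.≤-trans (s≤s (proj₁ (proj₂ onward))) (ℕₚ.≤-reflexive (sym h≡)) , step E.edge (proj₂ (proj₂ onward))
      where
      every : Fin n → Bool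
      every _ = true
      i₀-crossed : margin σ c₂ i₀ ≤ 0ℤ
      i₀-crossed = ℤₚ.<⇒≤ (subst (_< 0ℤ) (sym opposite) (ℤₚ.neg-mono-< (c₂-τ i₀)))
        where
        opposite : margin σ c₂ i₀ ≡ - margin τ c₂ i₀
        opposite = trans (cong (_* height c₂ i₀) (sign-opposite σᵢ₀≢τᵢ₀)) (sym (ℤₚ.neg-distribˡ-* (sign (τ i₀)) (height c₂ i₀)))
      F = first-wall σ every c₁ c₂ (λ i _ → c₁-σ i) i₀ refl i₀-crossed
      open FirstWall F using (T; T-crossed)
      W′ = single-wall (count T) σ T c₁ ℕₚ.≤-refl (λ i _ → c₁-σ i) (FirstWall.k F) (FirstWall.k∈T F)
      open Wall (refine F W′)
      crossed : σ j ≢ τ j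
      crossed σⱼ≡τⱼ = ℤₚ.<⇒≱ (subst (λ b → 0ℤ < sign b * height c₂ j) (sym σⱼ≡τⱼ) (c₂-τ j)) (T-crossed j (Wall.j∈M W′))
      module E = OnWall w j σ on-wall (λ i → off-wall i refl)
      h≡ : hamming σ τ ≡ suc (hamming (flip σ j) τ)
      h≡ = hamming-flip σ τ j crossed
      onward : Path (flip σ j) τ
      onward = path fuel (flip σ j) τ (E.tilt not) c₂
        (ℕₚ.≤-pred (ℕₚ.≤-trans (ℕₚ.≤-reflexive (sym h≡)) h≤fuel)) (E.tilt-realizes not) c₂-τ

    diameter≤#generators : ∀ {δ} → Diameter S δ → δ ℕ.≤ n
    diameter≤#generators (_ , u , v , u-vertex , v-vertex , far) =
      ℕₚ.≤-trans (far m (subst₂ (λ x y → Walk S x y m) (sym (VertexData.v≡point U)) (sym (VertexData.v≡point V)) walk))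
        (ℕₚ.≤-trans m≤h (hamming≤n (VertexData.σ U) (VertexData.σ V)))
      where
      U = IsVertex⇒VertexData u-vertex
      V = IsVertex⇒VertexData v-vertex
      P = path n (VertexData.σ U) (VertexData.σ V) (VertexData.c U) (VertexData.c V) (hamming≤n (VertexData.σ U) (VertexData.σ V))
            (VertexData.realizes U) (VertexData.realizes V)
      m = proj₁ P
      m≤h = proj₁ (proj₂ P)
      walk = proj₂ (proj₂ P)

    -- The vertices selected by c and by -c differ in every generator.
    #generators≤diameter : ∀ {δ} → Diameter S δ → ∀ c → Realizes c (λ _ → true) → n ℕ.≤ δ
    #generators≤diameter (connected , _) c c-top =
      ℕₚ.≤-trans (ℕₚ.≤-reflexive (sym (hamming-false-true n))) (ℕₚ.≤-trans (walk⇒hamming≤length walk _ _ refl refl) m≤δ)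
      where
      -c-bottom : Realizes (neg c) (λ _ → false)
      -c-bottom i = subst (0ℤ <_) (sym (trans (cong (-[1+ 0 ] *_) (dot-negˡ c (G i))) (trans (ℤₚ.-1*i≡-i (- height c i))
        (trans (ℤₚ.neg-involutive (height c i)) (sym (ℤₚ.*-identityˡ (height c i))))))) (c-top i)
      P = connected (point (λ _ → false)) (point (λ _ → true))
            (Realizes⇒IsVertex (neg c) (λ _ → false) -c-bottom) (Realizes⇒IsVertex c (λ _ → true) c-top)
      m≤δ = proj₁ (proj₂ P)
      walk = proj₂ (proj₂ P)

  ∈zonoPoints⇒point : ∀ {d} (t : Pt d) (gs : List (Pt d)) {w} → w ∈ zonoPoints t gs →
    ∃ λ σ → w ≡ t ⊕ subsetSum (lookup gs) σ
  ∈zonoPoints⇒point t gs w∈ with ∈-map⁻ (t ⊕_) w∈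
  ... | w′ , w′∈ , refl with ∈subsetSums⇒subsetSum gs w′∈
  ...   | σ , refl = σ , refl

  point∈zonoPoints : ∀ {d} (t : Pt d) (gs : List (Pt d)) σ → t ⊕ subsetSum (lookup gs) σ ∈ zonoPoints t gs
  point∈zonoPoints t gs σ = ∈-map⁺ (t ⊕_) (subsetSum∈subsetSums gs σ)

  module _ {d} (t : Pt d) (gs : List (Pt d)) (gens : ZonoGens gs) where

    private
      module Z = Zonotope (zonoPoints t gs) t (lookup gs) (∈zonoPoints⇒point t gs) (point∈zonoPoints t gs)
        (λ i → All.lookup (proj₁ gens) (∈-lookup i))
        (AllPairs-lookup (λ ¬xy yx → ¬xy (Collinear-sym yx)) (proj₂ gens))

    diameter≤length : ∀ {δ} → Diameter (zonoPoints t gs) δ → δ ℕ.≤ length gs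
    diameter≤length = Z.diameter≤#generators

    length≤diameter : ∀ c → All (λ g → 0ℤ < dot c g) gs → ∀ {δ} → Diameter (zonoPoints t gs) δ → length gs ℕ.≤ δ
    length≤diameter c c>0 diameter = Z.#generators≤diameter diameter c
      (λ i → subst (0ℤ <_) (sym (ℤₚ.*-identityˡ _)) (All.lookup c>0 (∈-lookup i)))

open import Defs
open PrimitivePart using (IsH1Gen-prim; H1Gen-collinear⇒≡)
open LexFunctional using (lexFunctional; lexFunctional-pos)
open GeneratorExchange using (l1Sum; Exchange; exchange; exchange-≤; exchange-<; exchange-tight)
open Width using (l1Sum≤d*k; d*k≤l1Sum-H1; d*k≤d*k′⇒k≤k′)
open ZonotopeGraph using (diameter≤length; length≤diameter)
open Translates using (matching⇒translate)
open ListFacts using (AllPairs-strengthen)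
open import Data.Nat using (ℕ; suc; _≤_; _<_; _*_)
import Data.Nat.Properties as ℕₚ
import Data.Integer as ℤ
open import Data.List using (List; length)
open import Data.List.Membership.Propositional using (_∈_)
open import Data.List.Relation.Unary.All as All using (All)
open import Data.List.Relation.Unary.Unique.Propositional using (Unique)
open import Data.Product using (_×_; _,_; proj₁; proj₂)
open import Function using (_∘_)
open import Function.Bundles using (_⇔_; Equivalence)
open import Relation.Binary.PropositionalEquality using (_≡_; subst)

module H₁ {d} (p : ℕ) (gH : List (Pt d)) (gH! : Unique gH) (gH-H1 : ∀ x → (x ∈ gH) ⇔ IsH1Gen p x) where

  private
    H1 : ∀ {x} → x ∈ gH → IsH1Gen p x
    H1 {x} = Equivalence.to (gH-H1 x)

  generators : ZonoGens gH
  generators = All.tabulate (proj₁ ∘ proj₁ ∘ H1) ,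
    AllPairs-strengthen (λ x-H1 y-H1 x≢y x~y → x≢y (H1Gen-collinear⇒≡ p _ _ x-H1 y-H1 x~y)) (All.tabulate H1) gH!

  lex-positive : All (λ g → ℤ.0ℤ ℤ.< dot (lexFunctional (suc p) d) g) gH
  lex-positive = All.tabulate λ g∈ → lexFunctional-pos p d _ (proj₂ (proj₂ (H1 g∈))) (proj₁ (proj₂ (H1 g∈)))

  exchange-with : ∀ gZ → ZonoGens gZ → Exchange p gZ gH
  exchange-with gZ (gZ≢0 , gZ-pairwise) = exchange p gZ gH gZ≢0 gZ-pairwise (proj₁ ∘ proj₂ ∘ H1)
    (λ {g} g∈ small → Equivalence.from (gH-H1 _) (IsH1Gen-prim p g (All.lookup gZ≢0 g∈) small))

theorem3p1 : (d p : ℕ) → 1 ≤ p →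
    -- H = H₁(d,p): generators are exactly the H₁-generators, each once
    (gH : List (Pt d)) → Unique gH → (∀ x → (x ∈ gH) ⇔ IsH1Gen p x) →
    -- Z = t + Σ [0,g], a d-dimensional lattice zonotope
    (t : Pt d) (gZ : List (Pt d)) → ZonoGens gZ → FullDim (zonoPoints t gZ) →
    (δH δZ kH kZ : ℕ) →
    Diameter (zonoPoints zeroV gH) δH → Diameter (zonoPoints t gZ) δZ →
    KVal (zonoPoints zeroV gH) kH → KVal (zonoPoints t gZ) kZ →
    (δH ≤ δZ → kH ≤ kZ) ×
    (δH < δZ → kH < kZ) ×
    (δH ≡ δZ → kH ≡ kZ → IsTranslateOf (zonoPoints t gZ) (zonoPoints zeroV gH))
theorem3p1 d p _ gH gH! gH-H1 t gZ gZ-gens _ δH δZ kH kZ δ-H δ-Z k-H k-Z =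
  (λ δH≤δZ → d*k≤d*k′⇒k≤k′ k-H (ℕₚ.≤-trans d*kH≤∑H (ℕₚ.≤-trans (exchange-≤ X (N≤n δH≤δZ)) ∑Z≤d*kZ))) ,
  (λ δH<δZ → ℕₚ.*-cancelˡ-< d kH kZ (ℕₚ.≤-<-trans d*kH≤∑H (ℕₚ.<-≤-trans (exchange-< X (N<n δH<δZ)) ∑Z≤d*kZ))) ,
  (λ δH≡δZ kH≡kZ → matching⇒translate t gZ gH gZ-gens gH!
     (exchange-tight X (N≤n (ℕₚ.≤-reflexive δH≡δZ)) (ℕₚ.≤-trans ∑Z≤d*kZ (subst (λ k → d * k ≤ _) kH≡kZ d*kH≤∑H))))
  where
  open H₁ p gH gH! gH-H1
  X : Exchange p gZ gH
  X = exchange-with gZ gZ-gens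
  N≤δH : length gH ≤ δH
  N≤δH = length≤diameter zeroV gH generators (lexFunctional (suc p) d) lex-positive δ-H
  δZ≤n : δZ ≤ length gZ
  δZ≤n = diameter≤length t gZ gZ-gens δ-Z
  N≤n : δH ≤ δZ → length gH ≤ length gZ
  N≤n δH≤δZ = ℕₚ.≤-trans N≤δH (ℕₚ.≤-trans δH≤δZ δZ≤n)
  N<n : δH < δZ → length gH < length gZ
  N<n δH<δZ = ℕₚ.≤-<-trans N≤δH (ℕₚ.<-≤-trans δH<δZ δZ≤n)
  ∑Z≤d*kZ : l1Sum gZ ≤ d * kZ
  ∑Z≤d*kZ = l1Sum≤d*k t gZ kZ (proj₁ k-Z)
  d*kH≤∑H : d * kH ≤ l1Sum gH
  d*kH≤∑H = d*k≤l1Sum-H1 p gH gH! gH-H1 kH k-H
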